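{- Let $A$ be a collection of connected graphs all having exactly $d$ vertices, and let $\mathbf g$ be a finite simple graph on $n$ vertices. Then $\Psi_{\zeta_A}(\mathbf g)=\sum_{\pi\in\Pi_A(\mathbf g)}X_{\mathbf g_{\downarrow\pi}}(\mathbf x^d).$ In particular $\Psi_{\zeta_A}(\mathbf g)=0$ if $d$ does not divide $n$.
   Context: Graphs are considered up to isomorphism; "$\mathbf h\in A$" means $\mathbf h$ is isomorphic to a member of $A$. The character $\zeta_A$ on graphs is multiplicative over disjoint unions: $\zeta_A(\mathbf h)=1$ if every connected component of $\mathbf h$ is in $A$ (in particular $\zeta_A$ of the empty graph is $1$), and $0$ otherwise. For $\mathbf g$ with vertex set $V$, $|V|=n$, $\Psi_{\zeta_A}(\mathbf g)=\sum_{\alpha\models n}\Big(\sum_{(B_1,\dots,B_\ell)}\prod_{i}\zeta_A(\mathbf g|_{B_i})\Big)M_\alpha$, the inner sum over ordered set partitions $(B_1,\dots,B_\ell)$ of $V$ with $|B_i|=\alpha_i$, where $\mathbf g|_B$ is the induced subgraph and $M_\alpha=\sum_{i_1<\dots<i_\ell}x_{i_1}^{\alpha_1}\cdots x_{i_\ell}^{\alpha_\ell}$. $\Pi_A(\mathbf g)$ is the set of set partitions $\pi=\pi_1/\cdots/\pi_\ell$ of $V$ with $\mathbf g|_{\pi_i}\in A$ for all $i$. $\mathbf g_{\downarrow\pi}$ is the simple graph with vertices the blocks of $\pi$, two blocks adjacent iff some edge of $\mathbf g$ joins them. $X_{\mathbf h}$ is the chromatic symmetric function (sum over proper colorings by positive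 integers), and $F(\mathbf x^d)$ is $F$ with each $x_i$ replaced by $x_i^d$. -}

module Defs where

open import Data.Bool using (Bool; true; false; _∧_; _∨_; not; if_then_else_)
open import Data.Nat using (ℕ; zero; suc; _+_; _*_; _∸_; _<_) renaming (_≡ᵇ_ to _==ℕ_)
open import Data.Fin using (Fin; toℕ) renaming (_≟_ to _≟F_)
open import Data.List using (List; []; _∷_; length; map; concatMap; allFin; upTo)
open import Data.Nat.ListAction using (sum)
import Data.Bool.ListAction as BL
import Data.List as L
open import Data.List.Properties using (≡-dec)
open import Data.Vec using (Vec; []; _∷_; lookup; tabulate)
open import Data.Product using (_×_)
open import Relation.Nullary.Decidable using (⌊_⌋)
open import Relation.Binary.PropositionalEquality using (_≡_)
import Data.Nat as N

anyF : (n : ℕ) → (Fin n → Bool) → Bool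
anyF n p = BL.any p (allFin n)

allF : (n : ℕ) → (Fin n → Bool) → Bool
allF n p = BL.all p (allFin n)

count : {A : Set} → (A → Bool) → List A → ℕ
count p [] = 0
count p (x ∷ xs) = (if p x then 1 else 0) + count p xs

card : (n : ℕ) → (Fin n → Bool) → ℕ
card n p = count p (allFin n)

_==F_ : {n : ℕ} → Fin n → Fin n → Bool
a ==F b = ⌊ a ≟F b ⌋

_<F_ : {n : ℕ} → Fin n → Fin n → Bool
a <F b = toℕ a N.<ᵇ toℕ b

allVecs : (ℓ n : ℕ) → List (Vec (Fin ℓ) n)
allVecs ℓ zero = [] ∷ []
allVecs ℓ (suc n) = concatMap (λ x → map (x ∷_) (allVecs ℓ n)) (allFin ℓ)

Graph : ℕ → Set
Graph n = Vec (Vec Bool n) n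

adj : {n : ℕ} → Graph n → Fin n → Fin n → Bool
adj g u v = lookup (lookup g u) v

IsSimple : {n : ℕ} → Graph n → Set
IsSimple {n} g = (∀ u v → adj g u v ≡ adj g v u) × (∀ u → adj g u u ≡ false)

-- reachB g B k u v : there is a walk of length ≤ k from u to v all of
-- whose vertices after u lie in the vertex subset B
reachB : {n : ℕ} → Graph n → (Fin n → Bool) → ℕ → Fin n → Fin n → Bool
reachB g B zero u v = u ==F v
reachB {n} g B (suc k) u v =
  reachB g B k u v ∨ anyF n (λ w → reachB g B k u w ∧ B v ∧ adj g w v)

Connected : {d : ℕ} → Graph d → Set
Connected {d} h = (0 < d) × (∀ u v → reachB h (λ _ → true) d u v ≡ true)

pullback : {d n : ℕ} → Graph n → Vec (Fin n) d → Graph d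
pullback g φ = tabulate λ i → tabulate λ j → adj g (lookup φ i) (lookup φ j)

-- "g|_B ∈ A": the induced subgraph of g on the vertex subset B is
-- isomorphic to a member of A (A is a collection of graphs on Fin d)
inA : {d n : ℕ} → (Graph d → Bool) → Graph n → (Fin n → Bool) → Bool
inA {d} {n} A g B = BL.any ok (allVecs n d)
  where
  ok : Vec (Fin n) d → Bool
  ok φ = allF d (λ i → allF d (λ j → (i ==F j) ∨ not (lookup φ i ==F lookup φ j)))
       ∧ allF d (λ i → B (lookup φ i))
       ∧ allF n (λ v → not (B v) ∨ anyF d (λ i → lookup φ i ==F v))
       ∧ A (pullback g φ)

component : {n : ℕ} → Graph n → (Fin n → Bool) → Fin n → (Fin n → Bool)
component {n} g B v u = B u ∧ reachB g B n v u

zetaA : {d n : ℕ} → (Graph d → Bool) → Graph n → (Fin n → Bool) → Bool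
zetaA {d} {n} A g B = allF n (λ v → not (B v) ∨ inA A g (component g B v))

-- Quasisymmetric functions are given by their coefficients: a monomial
-- x_1^{e_1} ... x_k^{e_k} is encoded as the exponent list e = e_1 ∷ ... ∷ e_k.

-- compositions of n (lists of positive integers summing to n); fuel ≥ n
compsF : ℕ → ℕ → List (List ℕ)
compsF fuel zero = [] ∷ []
compsF zero (suc m) = []
compsF (suc f) (suc m) =
  concatMap (λ p → map (suc p ∷_) (compsF f (m ∸ p))) (upTo (suc m))

compositions : ℕ → List (List ℕ)
compositions n = compsF n n

compress : List ℕ → List ℕ
compress [] = []
compress (zero ∷ e) = compress e
compress (suc x ∷ e) = suc x ∷ compress e

-- coefficient of x^e in M_α
coeffM : List ℕ → List ℕ → ℕ
coeffM α e = if ⌊ ≡-dec N._≟_ (compress e) α ⌋ then 1 else 0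

block : {ℓ n : ℕ} → Vec (Fin ℓ) n → Fin ℓ → (Fin n → Bool)
block f i v = lookup f v ==F i

-- Σ over ordered set partitions (B_1,…,B_ℓ) with |B_i| = α_i of ∏ ζ_A(g|_{B_i})
orderedCount : {d n : ℕ} → (Graph d → Bool) → Graph n → List ℕ → ℕ
orderedCount {d} {n} A g α =
  count (λ f → allF (length α) (λ i →
            (card n (block f i) ==ℕ L.lookup α i) ∧ zetaA A g (block f i)))
        (allVecs (length α) n)

-- coefficient of x^e in Ψ_{ζ_A}(g)
coeffΨ : {d n : ℕ} → (Graph d → Bool) → Graph n → List ℕ → ℕ
coeffΨ {d} {n} A g e =
  sum (map (λ α → orderedCount A g α * coeffM α e) (compositions n))

-- Set partitions of Fin n into ℓ blocks, encoded canonically as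
-- surjective restricted-growth labellings f : Fin n → Fin ℓ
-- (blocks are numbered in the order of their smallest elements).

isSetPartition : {ℓ n : ℕ} → Vec (Fin ℓ) n → Bool
isSetPartition {ℓ} {n} f =
  allF ℓ (λ a → anyF n (λ v → lookup f v ==F a))
  ∧ allF n (λ v → allF ℓ (λ a → not (a <F lookup f v)
                      ∨ anyF n (λ u → (u <F v) ∧ (lookup f u ==F a))))

inPiA : {d n ℓ : ℕ} → (Graph d → Bool) → Graph n → Vec (Fin ℓ) n → Bool
inPiA {d} {n} {ℓ} A g f = isSetPartition f ∧ allF ℓ (λ i → inA A g (block f i))

quotient : {ℓ n : ℕ} → Graph n → Vec (Fin ℓ) n → Graph ℓ
quotient {ℓ} {n} g f = tabulate λ a → tabulate λ b →
  not (a ==F b) ∧ anyF n (λ u → anyF n (λ v →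
    (lookup f u ==F a) ∧ (lookup f v ==F b) ∧ adj g u v))

-- coefficient of x^e in X_h(x^d): number of proper colourings κ of h
-- with d·|κ⁻¹(i)| = e_i for every colour i (colours beyond length e
-- would need exponent 0, hence are unused).
coeffXd : {ℓ : ℕ} → Graph ℓ → ℕ → List ℕ → ℕ
coeffXd {ℓ} h d e =
  count (λ κ → allF ℓ (λ a → allF ℓ (λ b →
                   not (adj h a b) ∨ not (lookup κ a ==F lookup κ b)))
             ∧ allF (length e) (λ i →
                   (d * card ℓ (λ a → lookup κ a ==F i)) ==ℕ L.lookup e i))
        (allVecs (length e) ℓ)

-- coefficient of x^e in Σ_{π ∈ Π_A(g)} X_{g↓π}(x^d)
coeffRHS : {d n : ℕ} → (Graph d → Bool) → Graph n → List ℕ → ℕ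
coeffRHS {d} {n} A g e =
  sum (map (λ ℓ → sum (map (λ f → if inPiA A g f then coeffXd (quotient g f) d e else 0)
                           (allVecs ℓ n)))
           (upTo (suc n)))

-- The coefficient of x^e in Ψ_{ζ_A}(g) counts labellings G : V → {1,…,k} (k the length of e) whose
-- i-th colour class has e_i vertices and only components in A: the monomial quasisymmetric functions
-- pick out the composition obtained from e by deleting zeros, and zero parts only add empty classes.
-- The coefficient on the right counts triples (π, κ) with π ∈ Π_A(g) and κ a proper colouring of
-- g↓π whose i-th class has e_i / d blocks. The map (π, κ) ↦ κ ∘ π is a bijection between the two:
-- the blocks of π are connected and κ is proper, so the blocks of π are exactly the connected
-- components of the colour classes of κ ∘ π, which recovers π (as a restricted growth labelling) and
-- then κ. As every block of π has d vertices, a triple can only exist when d divides n.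

module Submission where

open import Defs
open import Algebra.Properties.CommutativeSemigroup using (interchange)
open import Axiom.UniquenessOfIdentityProofs using (module Decidable⇒UIP)
open import Data.Bool using (Bool; true; false; T; _∧_; _∨_; not; if_then_else_)
open import Data.Bool.Properties using (T-∧; T-∨; T-≡; ∧-zeroʳ) renaming (_≟_ to _≟B_)
import Data.Bool.ListAction as BL
open import Data.Empty using (⊥-elim)
open import Data.Fin using (Fin; zero; suc; toℕ; fromℕ<) renaming (_≟_ to _≟F_)
import Data.Fin.Properties as Fin
open import Data.Fin.Induction using (<-wellFounded)
open import Data.List using (List; []; _∷_; length; map; concatMap; _++_; allFin; upTo)
import Data.List as List
import Data.List.Properties as List
open import Data.List.Membership.Propositional using (_∈_; _∉_)
open import Data.List.Membership.Propositional.Properties using (∈-allFin; ∈-map⁺; ∈-concatMap⁺; ∈-upTo⁺; ∈-upTo⁻)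
import Data.List.Relation.Unary.All as All
open import Data.List.Relation.Unary.All.Properties using (all⁺; all⁻)
open import Data.List.Relation.Unary.AllPairs using (_∷_)
open import Data.List.Relation.Unary.Any using (here; there)
import Data.List.Relation.Unary.Any as Any
open import Data.List.Relation.Unary.Any.Properties using (any⁺; any⁻)
open import Data.List.Relation.Unary.Unique.Propositional using (Unique)
open import Data.List.Relation.Unary.Unique.Propositional.Properties using (allFin⁺; upTo⁺)
open import Data.Nat using (ℕ; zero; suc; _+_; _*_; _∸_; _≤_; _<_; z≤n; s≤s; _≡ᵇ_; _<ᵇ_; _≤′_; ≤′-refl; ≤′-step)
open import Data.Nat.Divisibility using (_∣_; divides)
open import Data.Nat.ListAction using (sum)
open import Data.Nat.Properties
open import Data.Product using (Σ; ∃; _×_; _,_; proj₁; proj₂)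
import Data.Product.Properties as Product
open import Data.Sum using (_⊎_; inj₁; inj₂)
open import Data.Vec using (Vec; []; _∷_; lookup; tabulate)
import Data.Vec as Vec
import Data.Vec.Properties as Vec
open import Function using (_∘_; _⇔_; mk⇔)
open import Function.Bundles using (Equivalence)
import Induction.WellFounded as WF
open import Level using (0ℓ)
open import Relation.Binary.Definitions using (DecidableEquality; tri<; tri≈; tri>)
open import Relation.Binary.PropositionalEquality
open import Relation.Nullary using (¬_; yes; no; ¬?; Dec)
open import Relation.Nullary.Decidable using (⌊_⌋; toWitness; fromWitness; T?; _×-dec_; decidable-stable)

T-ext : ∀ {a b} → (T a → T b) → (T b → T a) → a ≡ b
T-ext {true}  {true}  _ _ = refl
T-ext {true}  {false} f _ = ⊥-elim (f _)
T-ext {false} {true}  _ g = ⊥-elim (g _)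
T-ext {false} {false} _ _ = refl

∧-elim : ∀ {a b} → T (a ∧ b) → T a × T b
∧-elim = Equivalence.to T-∧

∧-intro : ∀ {a b} → T a → T b → T (a ∧ b)
∧-intro x y = Equivalence.from T-∧ (x , y)

∨-elim : ∀ {a b} → T (a ∨ b) → T a ⊎ T b
∨-elim = Equivalence.to T-∨

∨-introˡ : ∀ {a b} → T a → T (a ∨ b)
∨-introˡ x = Equivalence.from T-∨ (inj₁ x)

∨-introʳ : ∀ {a b} → T b → T (a ∨ b)
∨-introʳ y = Equivalence.from T-∨ (inj₂ y)

not-elim : ∀ {a} → T (not a) → ¬ T a
not-elim {false} _ ()

not-intro : ∀ {a} → ¬ T a → T (not a)
not-intro {true}  ¬a = ¬a _
not-intro {false} _  = _

⇒-intro : ∀ {a b} → (T a → T b) → T (not a ∨ b)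
⇒-intro {true}  f = f _
⇒-intro {false} _ = _

⇒-elim : ∀ {a b} → T (not a ∨ b) → T a → T b
⇒-elim {true} b _ = b

module _ {X : Set} (_≟_ : DecidableEquality X) where

  ⌊≟⌋-cong : {Y : Set} (_≟′_ : DecidableEquality Y) {x y : X} {x′ y′ : Y}
    → (x ≡ y → x′ ≡ y′) → (x′ ≡ y′ → x ≡ y) → ⌊ x ≟ y ⌋ ≡ ⌊ x′ ≟′ y′ ⌋
  ⌊≟⌋-cong _ f g = T-ext (fromWitness ∘ f ∘ toWitness) (fromWitness ∘ g ∘ toWitness)

  ⌊≟⌋-refl : ∀ x → T ⌊ x ≟ x ⌋
  ⌊≟⌋-refl x = fromWitness refl

  ⌊≟⌋-sym : ∀ x y → ⌊ x ≟ y ⌋ ≡ ⌊ y ≟ x ⌋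
  ⌊≟⌋-sym x y = ⌊≟⌋-cong _≟_ sym sym

module _ {n : ℕ} {p : Fin n → Bool} where

  allF⁻ : T (allF n p) → ∀ i → T (p i)
  allF⁻ t i = All.lookup (all⁺ p (allFin n) t) (∈-allFin i)

  allF⁺ : (∀ i → T (p i)) → T (allF n p)
  allF⁺ h = all⁻ p {allFin n} (All.tabulate (λ {i} _ → h i))

  anyF⁻ : T (anyF n p) → ∃ λ i → T (p i)
  anyF⁻ t = Any.satisfied (any⁻ p (allFin n) t)

  anyF⁺ : ∀ i → T (p i) → T (anyF n p)
  anyF⁺ i pi = any⁺ p (Any.map (λ { refl → pi }) (∈-allFin i))

-- Counting

𝟙 : Bool → ℕ
𝟙 b = if b then 1 else 0

module _ {X : Set} where

  count-cong : ∀ {p q : X → Bool} → (∀ x → p x ≡ q x) → ∀ xs → count p xs ≡ count q xs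
  count-cong p≗q []       = refl
  count-cong p≗q (x ∷ xs) = cong₂ _+_ (cong 𝟙 (p≗q x)) (count-cong p≗q xs)

  count-none : ∀ {p : X → Bool} xs → (∀ x → ¬ T (p x)) → count p xs ≡ 0
  count-none         []       _    = refl
  count-none {p = p} (x ∷ xs) none with p x | none x
  ... | false | _  = count-none xs none
  ... | true  | ¬t = ⊥-elim (¬t _)

  count-∧ˡ : ∀ b (p : X → Bool) xs → count (λ x → b ∧ p x) xs ≡ (if b then count p xs else 0)
  count-∧ˡ true  p xs = refl
  count-∧ˡ false p xs = count-none xs (λ _ ())

  count-++ : ∀ (p : X → Bool) xs ys → count p (xs ++ ys) ≡ count p xs + count p ys
  count-++ p []       ys = refl
  count-++ p (x ∷ xs) ys = trans (cong (𝟙 (p x) +_) (count-++ p xs ys)) (sym (+-assoc (𝟙 (p x)) _ _))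

  count-mono : ∀ {p q : X → Bool} → (∀ x → T (p x) → T (q x)) → ∀ xs → count p xs ≤ count q xs
  count-mono                 p⇒q []       = z≤n
  count-mono {p = p} {q = q} p⇒q (x ∷ xs) with p x | q x | p⇒q x
  ... | true  | true  | _ = s≤s (count-mono p⇒q xs)
  ... | true  | false | f = ⊥-elim (f _)
  ... | false | true  | _ = m≤n⇒m≤1+n (count-mono p⇒q xs)
  ... | false | false | _ = count-mono p⇒q xs

  count-mono-< : ∀ {p q : X → Bool} → (∀ x → T (p x) → T (q x))
    → ∀ {x xs} → x ∈ xs → T (q x) → ¬ T (p x) → count p xs < count q xs
  count-mono-< {p = p} {q = q} p⇒q {xs = y ∷ xs} (here refl) qy ¬py with p y | q y
  ... | true  | _     = ⊥-elim (¬py _)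
  ... | false | true  = s≤s (count-mono p⇒q xs)
  count-mono-< {p = p} {q = q} p⇒q {xs = y ∷ xs} (there x∈xs) qx ¬px with p y | q y | p⇒q y
  ... | true  | true  | _ = s≤s (count-mono-< p⇒q x∈xs qx ¬px)
  ... | true  | false | f = ⊥-elim (f _)
  ... | false | true  | _ = m≤n⇒m≤1+n (count-mono-< p⇒q x∈xs qx ¬px)
  ... | false | false | _ = count-mono-< p⇒q x∈xs qx ¬px

  count-sum : ∀ (p : X → Bool) xs → count p xs ≡ sum (map (𝟙 ∘ p) xs)
  count-sum p []       = refl
  count-sum p (x ∷ xs) = cong (𝟙 (p x) +_) (count-sum p xs)

  count-true : ∀ (xs : List X) → count (λ _ → true) xs ≡ length xs
  count-true []       = refl
  count-true (x ∷ xs) = cong suc (count-true xs)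

  sum-map-+ : ∀ (f g : X → ℕ) xs → sum (map (λ x → f x + g x) xs) ≡ sum (map f xs) + sum (map g xs)
  sum-map-+ f g []       = refl
  sum-map-+ f g (x ∷ xs) = trans (cong (f x + g x +_) (sum-map-+ f g xs))
                                 (interchange +-commutativeSemigroup (f x) (g x) _ _)

  sum-map-const : ∀ c (xs : List X) → sum (map (λ _ → c) xs) ≡ length xs * c
  sum-map-const c []       = refl
  sum-map-const c (x ∷ xs) = cong (c +_) (sum-map-const c xs)

  sum-map-if : ∀ (b : X → Bool) c xs → sum (map (λ x → if b x then c else 0) xs) ≡ count b xs * c
  sum-map-if b c []       = refl
  sum-map-if b c (x ∷ xs) with b x
  ... | true  = cong (c +_) (sum-map-if b c xs)
  ... | false = sum-map-if b c xs

module _ {X Y : Set} where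

  count-map : ∀ (p : Y → Bool) (f : X → Y) xs → count p (map f xs) ≡ count (p ∘ f) xs
  count-map p f []       = refl
  count-map p f (x ∷ xs) = cong (𝟙 (p (f x)) +_) (count-map p f xs)

  count-concatMap : ∀ (p : Y → Bool) (f : X → List Y) xs
    → count p (concatMap f xs) ≡ sum (map (count p ∘ f) xs)
  count-concatMap p f []       = refl
  count-concatMap p f (x ∷ xs) =
    trans (count-++ p (f x) (concatMap f xs)) (cong (count p (f x) +_) (count-concatMap p f xs))

  double-counting : ∀ (R : X → Y → Bool) xs ys
    → sum (map (λ y → count (λ x → R x y) xs) ys) ≡ sum (map (λ x → count (R x) ys) xs)
  double-counting R []       ys = trans (sum-map-const 0 ys) (*-zeroʳ (length ys))
  double-counting R (x ∷ xs) ys = begin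
    sum (map (λ y → 𝟙 (R x y) + count (λ x → R x y) xs) ys)
      ≡⟨ sum-map-+ (𝟙 ∘ R x) _ ys ⟩
    sum (map (𝟙 ∘ R x) ys) + sum (map (λ y → count (λ x → R x y) xs) ys)
      ≡⟨ cong₂ _+_ (sym (count-sum (R x) ys)) (double-counting R xs ys) ⟩
    count (R x) ys + sum (map (λ x → count (R x) ys) xs) ∎
    where open ≡-Reasoning

  count-fibres : ∀ (R : X → Y → Bool) (P : X → Bool) xs ys
    → (∀ x → T (P x) → count (R x) ys ≡ 1)
    → count P xs ≡ sum (map (λ y → count (λ x → P x ∧ R x y) xs) ys)
  count-fibres R P xs ys unique = begin
    count P xs
      ≡⟨ count-sum P xs ⟩
    sum (map (𝟙 ∘ P) xs)
      ≡⟨ cong sum (List.map-cong fibre xs) ⟩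
    sum (map (λ x → count (λ y → P x ∧ R x y) ys) xs)
      ≡⟨ double-counting (λ x y → P x ∧ R x y) xs ys ⟨
    sum (map (λ y → count (λ x → P x ∧ R x y) xs) ys) ∎
    where
    open ≡-Reasoning
    fibre : ∀ x → 𝟙 (P x) ≡ count (λ y → P x ∧ R x y) ys
    fibre x with P x in Px
    ... | true  = sym (unique x (subst T (sym Px) _))
    ... | false = sym (count-∧ˡ false (R x) ys)

𝟙-intro : ∀ {m} b → (T b → m ≡ 1) → (¬ T b → m ≡ 0) → m ≡ 𝟙 b
𝟙-intro true  one _    = one _
𝟙-intro false _   none = none (λ ())

module _ {X : Set} (_≟_ : DecidableEquality X) where

  OccursOnce : X → List X → Set
  OccursOnce x xs = count (λ y → ⌊ y ≟ x ⌋) xs ≡ 1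

  count-∉ : ∀ {x xs} → x ∉ xs → count (λ y → ⌊ y ≟ x ⌋) xs ≡ 0
  count-∉ {x} {[]}     _   = refl
  count-∉ {x} {y ∷ xs} x∉ with y ≟ x
  ... | yes refl = ⊥-elim (x∉ (here refl))
  ... | no _     = count-∉ (x∉ ∘ there)

  unique⇒occursOnce : ∀ {x xs} → Unique xs → x ∈ xs → OccursOnce x xs
  unique⇒occursOnce {x} (x≢xs ∷ _) (here refl) with x ≟ x
  ... | yes _  = cong suc (count-∉ (λ x∈xs → All.lookup x≢xs x∈xs refl))
  ... | no x≢x = ⊥-elim (x≢x refl)
  unique⇒occursOnce {x} {y ∷ _} (y≢xs ∷ u) (there x∈xs) with y ≟ x
  ... | yes refl = ⊥-elim (All.lookup y≢xs x∈xs refl)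
  ... | no _     = unique⇒occursOnce u x∈xs

count-bijection : {X Y : Set} (_≟X_ : DecidableEquality X) (_≟Y_ : DecidableEquality Y)
  (p : X → Bool) (q : Y → Bool) (h : X → Y) (xs : List X) (ys : List Y)
  → (∀ x → T (p x) → OccursOnce _≟X_ x xs)
  → (∀ y → T (q y) → OccursOnce _≟Y_ y ys)
  → (∀ x → T (p x) → T (q (h x)))
  → (∀ x x′ → T (p x) → T (p x′) → h x ≡ h x′ → x ≡ x′)
  → (∀ y → T (q y) → ∃ λ x → T (p x) × h x ≡ y)
  → count p xs ≡ count q ys
count-bijection _≟X_ _≟Y_ p q h xs ys once-xs once-ys p⇒q injective surjective = begin
  count p xs
    ≡⟨ count-fibres (λ x y → ⌊ y ≟Y h x ⌋) p xs ys (λ x px → once-ys (h x) (p⇒q x px)) ⟩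
  sum (map (λ y → count (λ x → p x ∧ ⌊ y ≟Y h x ⌋) xs) ys)
    ≡⟨ cong sum (List.map-cong fibre ys) ⟩
  sum (map (𝟙 ∘ q) ys)
    ≡⟨ count-sum q ys ⟨
  count q ys ∎
  where
  open ≡-Reasoning
  fibre : ∀ y → count (λ x → p x ∧ ⌊ y ≟Y h x ⌋) xs ≡ 𝟙 (q y)
  fibre y = 𝟙-intro (q y) nonempty empty
    where
    nonempty : T (q y) → count (λ x → p x ∧ ⌊ y ≟Y h x ⌋) xs ≡ 1
    nonempty qy with surjective y qy
    ... | x₀ , px₀ , refl = trans (count-cong (λ x → T-ext to from) xs) (once-xs x₀ px₀)
      where
      to : ∀ {x} → T (p x ∧ ⌊ h x₀ ≟Y h x ⌋) → T ⌊ x ≟X x₀ ⌋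
      to {x} t = let px , e = ∧-elim t in fromWitness (injective x x₀ px px₀ (sym (toWitness e)))
      from : ∀ {x} → T ⌊ x ≟X x₀ ⌋ → T (p x ∧ ⌊ h x₀ ≟Y h x ⌋)
      from t with toWitness t
      ... | refl = ∧-intro px₀ (fromWitness refl)
    empty : ¬ T (q y) → count (λ x → p x ∧ ⌊ y ≟Y h x ⌋) xs ≡ 0
    empty ¬qy = count-none xs λ x t → let px , e = ∧-elim t in
      ¬qy (subst (T ∘ q) (sym (toWitness e)) (p⇒q x px))

occursOnce-allFin : ∀ {n} (i : Fin n) → OccursOnce _≟F_ i (allFin n)
occursOnce-allFin {n} i = unique⇒occursOnce _≟F_ (allFin⁺ n) (∈-allFin i)

occursOnce-upTo : ∀ {ℓ m} → ℓ < m → OccursOnce _≟_ ℓ (upTo m)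
occursOnce-upTo {m = m} ℓ<m = unique⇒occursOnce _≟_ (upTo⁺ m) (∈-upTo⁺ ℓ<m)

count-upTo-≥ : ∀ {ℓ m} → m ≤ ℓ → count (λ y → ⌊ y ≟ ℓ ⌋) (upTo m) ≡ 0
count-upTo-≥ m≤ℓ = count-∉ _≟_ (λ ℓ∈ → <⇒≱ (∈-upTo⁻ ℓ∈) m≤ℓ)

_≟V_ : ∀ {ℓ n} → DecidableEquality (Vec (Fin ℓ) n)
_≟V_ = Vec.≡-dec _≟F_

⌊≟V⌋-∷ : ∀ {ℓ n} (x y : Fin ℓ) (v w : Vec (Fin ℓ) n)
  → ⌊ (x ∷ v) ≟V (y ∷ w) ⌋ ≡ ⌊ x ≟F y ⌋ ∧ ⌊ v ≟V w ⌋
⌊≟V⌋-∷ x y v w with x ≟F y | v ≟V w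
... | yes _ | yes _ = refl
... | yes _ | no _  = refl
... | no _  | _     = refl

∈-allVecs : ∀ {ℓ n} (v : Vec (Fin ℓ) n) → v ∈ allVecs ℓ n
∈-allVecs []      = here refl
∈-allVecs {ℓ} {suc n} (x ∷ v) = ∈-concatMap⁺ (λ y → map (y ∷_) (allVecs ℓ n))
  (Any.map (λ { refl → ∈-map⁺ (x ∷_) (∈-allVecs v) }) (∈-allFin x))

occursOnce-allVecs : ∀ ℓ n (v : Vec (Fin ℓ) n) → OccursOnce _≟V_ v (allVecs ℓ n)
occursOnce-allVecs ℓ zero    []      = refl
occursOnce-allVecs ℓ (suc n) (y ∷ v) = begin
  count (λ w → ⌊ w ≟V (y ∷ v) ⌋) (concatMap (λ x → map (x ∷_) (allVecs ℓ n)) (allFin ℓ))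
    ≡⟨ count-concatMap _ _ (allFin ℓ) ⟩
  sum (map (λ x → count (λ w → ⌊ w ≟V (y ∷ v) ⌋) (map (x ∷_) (allVecs ℓ n))) (allFin ℓ))
    ≡⟨ cong sum (List.map-cong column (allFin ℓ)) ⟩
  sum (map (λ x → if ⌊ x ≟F y ⌋ then 1 else 0) (allFin ℓ))
    ≡⟨ sum-map-if (λ x → ⌊ x ≟F y ⌋) 1 (allFin ℓ) ⟩
  count (λ x → ⌊ x ≟F y ⌋) (allFin ℓ) * 1
    ≡⟨ cong (_* 1) (occursOnce-allFin y) ⟩
  1 ∎
  where
  open ≡-Reasoning
  column : ∀ x → count (λ w → ⌊ w ≟V (y ∷ v) ⌋) (map (x ∷_) (allVecs ℓ n)) ≡ (if ⌊ x ≟F y ⌋ then 1 else 0)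
  column x = begin
    count (λ w → ⌊ w ≟V (y ∷ v) ⌋) (map (x ∷_) (allVecs ℓ n))
      ≡⟨ count-map _ (x ∷_) (allVecs ℓ n) ⟩
    count (λ w → ⌊ (x ∷ w) ≟V (y ∷ v) ⌋) (allVecs ℓ n)
      ≡⟨ count-cong (λ w → ⌊≟V⌋-∷ x y w v) (allVecs ℓ n) ⟩
    count (λ w → ⌊ x ≟F y ⌋ ∧ ⌊ w ≟V v ⌋) (allVecs ℓ n)
      ≡⟨ count-∧ˡ ⌊ x ≟F y ⌋ _ (allVecs ℓ n) ⟩
    (if ⌊ x ≟F y ⌋ then count (λ w → ⌊ w ≟V v ⌋) (allVecs ℓ n) else 0)
      ≡⟨ cong (λ c → if ⌊ x ≟F y ⌋ then c else 0) (occursOnce-allVecs ℓ n v) ⟩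
    (if ⌊ x ≟F y ⌋ then 1 else 0) ∎

dependentProduct : {X : Set} {Y : X → Set} → List X → ((x : X) → List (Y x)) → List (Σ X Y)
dependentProduct xs ys = concatMap (λ x → map (x ,_) (ys x)) xs

module _ {X : Set} {Y : X → Set} where

  count-dependentProduct : ∀ (p : Σ X Y → Bool) xs ys
    → count p (dependentProduct xs ys) ≡ sum (map (λ x → count (p ∘ (x ,_)) (ys x)) xs)
  count-dependentProduct p xs ys = trans (count-concatMap p (λ x → map (x ,_) (ys x)) xs)
    (cong sum (List.map-cong (λ x → count-map p (x ,_) (ys x)) xs))

  occursOnce-dependentProduct : (_≟X_ : DecidableEquality X) (_≟Y_ : ∀ {x} → DecidableEquality (Y x))
    → ∀ {x y xs ys} → OccursOnce _≟X_ x xs → OccursOnce _≟Y_ y (ys x)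
    → OccursOnce (Product.≡-dec _≟X_ _≟Y_) (x , y) (dependentProduct xs ys)
  occursOnce-dependentProduct _≟X_ _≟Y_ {x} {y} {xs} {ys} once-x once-y = begin
    count (λ p → ⌊ p ≟Σ (x , y) ⌋) (dependentProduct xs ys)
      ≡⟨ count-dependentProduct _ xs ys ⟩
    sum (map (λ x′ → count (λ y′ → ⌊ (x′ , y′) ≟Σ (x , y) ⌋) (ys x′)) xs)
      ≡⟨ cong sum (List.map-cong fibre xs) ⟩
    sum (map (λ x′ → if ⌊ x′ ≟X x ⌋ then 1 else 0) xs)
      ≡⟨ sum-map-if _ 1 xs ⟩
    count (λ x′ → ⌊ x′ ≟X x ⌋) xs * 1
      ≡⟨ cong (_* 1) once-x ⟩
    1 ∎
    where
    open ≡-Reasoning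
    _≟Σ_ = Product.≡-dec _≟X_ _≟Y_
    fibre : ∀ x′ → count (λ y′ → ⌊ (x′ , y′) ≟Σ (x , y) ⌋) (ys x′) ≡ (if ⌊ x′ ≟X x ⌋ then 1 else 0)
    fibre x′ = 𝟙-intro ⌊ x′ ≟X x ⌋ (λ t → same x′ (toWitness t))
      (λ x′≢x → count-none (ys x′) (λ y′ t → x′≢x (fromWitness (Product.,-injectiveˡ (toWitness t)))))
      where
      same : ∀ x′ → x′ ≡ x → count (λ y′ → ⌊ (x′ , y′) ≟Σ (x , y) ⌋) (ys x′) ≡ 1
      same _ refl = trans (count-cong (λ y′ → ⌊≟⌋-cong _≟Σ_ _≟Y_
                      (Product.,-injectiveʳ-UIP (Decidable⇒UIP.≡-irrelevant _≟X_)) (cong (x ,_))) (ys x))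
                    once-y

module _ {n : ℕ} where

  card-fibres : ∀ {ℓ} (f : Fin n → Fin ℓ) (P : Fin n → Bool)
    → card n P ≡ sum (map (λ a → card n (λ v → P v ∧ ⌊ f v ≟F a ⌋)) (allFin ℓ))
  card-fibres {ℓ} f P = count-fibres (λ v a → ⌊ f v ≟F a ⌋) P (allFin n) (allFin ℓ)
    (λ v _ → trans (count-cong (λ a → ⌊≟⌋-sym _≟F_ (f v) a) (allFin ℓ)) (occursOnce-allFin (f v)))

  card-all : card n (λ _ → true) ≡ n
  card-all = trans (count-true (allFin n)) (List.length-tabulate (λ i → i))

  card-pos : ∀ (B : Fin n → Bool) v → T (B v) → 0 < card n B
  card-pos B v Bv = subst (_< card n B) (count-none (allFin n) (λ _ ()))
    (count-mono-< {p = λ _ → false} (λ _ ()) (∈-allFin v) Bv (λ ()))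

  ⊆-card-≡⇒⊇ : ∀ (B C : Fin n → Bool) → (∀ v → T (B v) → T (C v)) → card n B ≡ card n C
    → ∀ v → T (C v) → T (B v)
  ⊆-card-≡⇒⊇ B C B⊆C eq v Cv with T? (B v)
  ... | yes Bv = Bv
  ... | no ¬Bv = ⊥-elim (<-irrefl eq (count-mono-< B⊆C (∈-allFin v) Cv ¬Bv))

  card-∘ : ∀ {ℓ k d} (f : Fin n → Fin ℓ) (κ : Fin ℓ → Fin k) → (∀ a → card n (λ v → ⌊ f v ≟F a ⌋) ≡ d)
    → ∀ i → card n (λ v → ⌊ κ (f v) ≟F i ⌋) ≡ d * card ℓ (λ a → ⌊ κ a ≟F i ⌋)
  card-∘ {ℓ} {d = d} f κ uniform i = begin
    card n (λ v → ⌊ κ (f v) ≟F i ⌋)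
      ≡⟨ card-fibres f _ ⟩
    sum (map (λ a → card n (λ v → ⌊ κ (f v) ≟F i ⌋ ∧ ⌊ f v ≟F a ⌋)) (allFin ℓ))
      ≡⟨ cong sum (List.map-cong fibre (allFin ℓ)) ⟩
    sum (map (λ a → if ⌊ κ a ≟F i ⌋ then d else 0) (allFin ℓ))
      ≡⟨ sum-map-if _ d (allFin ℓ) ⟩
    card ℓ (λ a → ⌊ κ a ≟F i ⌋) * d
      ≡⟨ *-comm _ d ⟩
    d * card ℓ (λ a → ⌊ κ a ≟F i ⌋) ∎
    where
    open ≡-Reasoning
    on-fibre : ∀ a v → (⌊ κ (f v) ≟F i ⌋ ∧ ⌊ f v ≟F a ⌋) ≡ (⌊ κ a ≟F i ⌋ ∧ ⌊ f v ≟F a ⌋)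
    on-fibre a v with f v ≟F a
    ... | yes refl = refl
    ... | no _     = trans (∧-zeroʳ _) (sym (∧-zeroʳ _))
    fibre : ∀ a → card n (λ v → ⌊ κ (f v) ≟F i ⌋ ∧ ⌊ f v ≟F a ⌋) ≡ (if ⌊ κ a ≟F i ⌋ then d else 0)
    fibre a = trans (count-cong (on-fibre a) (allFin n))
      (trans (count-∧ˡ ⌊ κ a ≟F i ⌋ _ (allFin n)) (cong (λ c → if ⌊ κ a ≟F i ⌋ then c else 0) (uniform a)))

  card-uniform-blocks : ∀ {ℓ d} (f : Fin n → Fin ℓ) → (∀ a → card n (λ v → ⌊ f v ≟F a ⌋) ≡ d) → n ≡ ℓ * d
  card-uniform-blocks {ℓ} {d} f uniform = begin
    n                                                              ≡⟨ card-all ⟨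
    card n (λ _ → true)                                            ≡⟨ card-fibres f _ ⟩
    sum (map (λ a → card n (λ v → ⌊ f v ≟F a ⌋)) (allFin ℓ))        ≡⟨ cong sum (List.map-cong uniform (allFin ℓ)) ⟩
    sum (map (λ _ → d) (allFin ℓ))                                 ≡⟨ sum-map-const d (allFin ℓ) ⟩
    length (allFin ℓ) * d                                          ≡⟨ cong (_* d) (List.length-tabulate {n = ℓ} (λ i → i)) ⟩
    ℓ * d                                                          ∎
    where open ≡-Reasoning

lookup-ext : ∀ {X : Set} {m} (v w : Vec X m) → (∀ i → lookup v i ≡ lookup w i) → v ≡ w
lookup-ext v w eq = trans (sym (Vec.tabulate∘lookup v)) (trans (Vec.tabulate-cong eq) (Vec.tabulate∘lookup w))

-- Walks, induced subgraphs and quotient graphs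

module _ {n : ℕ} (g : Graph n) where

  reachB-refl : ∀ B k u → T (reachB g B k u u)
  reachB-refl B zero    u = fromWitness refl
  reachB-refl B (suc k) u = ∨-introˡ (reachB-refl B k u)

  reachB-extend : ∀ {B} k {u} w {v} → T (reachB g B k u w) → T (B v) → T (adj g w v) → T (reachB g B (suc k) u v)
  reachB-extend k w r Bv wv = ∨-introʳ (anyF⁺ w (∧-intro r (∧-intro Bv wv)))

  reachB-suc⁻ : ∀ {B} k {u v} → T (reachB g B (suc k) u v)
    → T (reachB g B k u v) ⊎ ∃ λ w → T (reachB g B k u w) × T (B v) × T (adj g w v)
  reachB-suc⁻ k r with ∨-elim r
  ... | inj₁ r′ = inj₁ r′
  ... | inj₂ t  = let w , rBa = anyF⁻ t ; r′ , Ba = ∧-elim rBa in inj₂ (w , r′ , ∧-elim Ba)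

  reachB-mono : ∀ {B k k′} → k ≤ k′ → ∀ {u v} → T (reachB g B k u v) → T (reachB g B k′ u v)
  reachB-mono k≤k′ = go (≤⇒≤′ k≤k′)
    where
    go : ∀ {B k k′} → k ≤′ k′ → ∀ {u v} → T (reachB g B k u v) → T (reachB g B k′ u v)
    go ≤′-refl      r = r
    go (≤′-step k≤) r = ∨-introˡ (go k≤ r)

  reachB-⊆ : ∀ {B B′} → (∀ x → T (B x) → T (B′ x)) → ∀ k {u v} → T (reachB g B k u v) → T (reachB g B′ k u v)
  reachB-⊆ B⊆B′ zero    r = r
  reachB-⊆ B⊆B′ (suc k) r with reachB-suc⁻ k r
  ... | inj₁ r′ = ∨-introˡ (reachB-⊆ B⊆B′ k r′)
  ... | inj₂ (w , r′ , Bv , wv) = reachB-extend k w (reachB-⊆ B⊆B′ k r′) (B⊆B′ _ Bv) wv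

  reachB-cong : ∀ {B B′} → (∀ v → B v ≡ B′ v) → ∀ k u v → reachB g B k u v ≡ reachB g B′ k u v
  reachB-cong B≗B′ k u v = T-ext (reachB-⊆ (λ x → subst T (B≗B′ x)) k) (reachB-⊆ (λ x → subst T (sym (B≗B′ x))) k)

  reachB-invariant : ∀ {B} (P : Fin n → Set) → (∀ w x → P w → T (B x) → T (adj g w x) → P x)
    → ∀ k {u v} → P u → T (reachB g B k u v) → P v
  reachB-invariant P step zero    Pu r with toWitness r
  ... | refl = Pu
  reachB-invariant P step (suc k) Pu r with reachB-suc⁻ k r
  ... | inj₁ r′ = reachB-invariant P step k Pu r′
  ... | inj₂ (w , r′ , Bv , wv) = step w _ (reachB-invariant P step k Pu r′) Bv wv

adj-pullback : ∀ {n d} (g : Graph n) (φ : Vec (Fin n) d) i j → adj (pullback g φ) i j ≡ adj g (lookup φ i) (lookup φ j)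
adj-pullback g φ i j = trans (cong (λ row → lookup row j) (Vec.lookup∘tabulate _ i)) (Vec.lookup∘tabulate _ j)

reachB-pullback : ∀ {n d} (g : Graph n) {B} (φ : Vec (Fin n) d) → (∀ i → T (B (lookup φ i)))
  → ∀ k {i j} → T (reachB (pullback g φ) (λ _ → true) k i j) → T (reachB g B k (lookup φ i) (lookup φ j))
reachB-pullback g φ φ∈B zero    r with toWitness r
... | refl = fromWitness refl
reachB-pullback g φ φ∈B (suc k) r with reachB-suc⁻ (pullback g φ) k r
... | inj₁ r′ = ∨-introˡ (reachB-pullback g φ φ∈B k r′)
... | inj₂ (w , r′ , _ , wj) = reachB-extend g k (lookup φ w) (reachB-pullback g φ φ∈B k r′) (φ∈B _)
                                 (subst T (adj-pullback g φ w _) wj)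

any-∈ : ∀ {X : Set} (p : X → Bool) {x xs} → x ∈ xs → T (p x) → T (BL.any p xs)
any-∈ p x∈xs px = any⁺ p (Any.map (λ { refl → px }) x∈xs)

record InducedCopy {d n : ℕ} (A : Graph d → Bool) (g : Graph n) (B : Fin n → Bool) : Set where
  field
    φ         : Vec (Fin n) d
    injective : ∀ i j → lookup φ i ≡ lookup φ j → i ≡ j
    into      : ∀ i → T (B (lookup φ i))
    onto      : ∀ v → T (B v) → ∃ λ i → lookup φ i ≡ v
    member    : T (A (pullback g φ))

module _ {d n : ℕ} (A : Graph d → Bool) (g : Graph n) where

  inA⁻ : ∀ {B} → T (inA A g B) → InducedCopy A g B
  inA⁻ {B} t = record
    { φ = φ ; injective = injective ; into = allF⁻ into ; onto = onto ; member = member }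
    where
    witness = Any.satisfied (any⁻ _ (allVecs n d) t)
    φ = proj₁ witness
    injective? = allF d (λ i → allF d (λ j → ⌊ i ≟F j ⌋ ∨ not ⌊ lookup φ i ≟F lookup φ j ⌋))
    into? = allF d (λ i → B (lookup φ i))
    onto? = allF n (λ v → not (B v) ∨ anyF d (λ i → ⌊ lookup φ i ≟F v ⌋))
    conditions : T (injective? ∧ into? ∧ onto? ∧ A (pullback g φ))
    conditions = proj₂ witness
    inj = proj₁ (∧-elim {injective?} conditions)
    rest = proj₂ (∧-elim {injective?} conditions)
    into = proj₁ (∧-elim {into?} rest)
    onto′ = proj₁ (∧-elim {onto?} (proj₂ (∧-elim {into?} rest)))
    member = proj₂ (∧-elim {onto?} (proj₂ (∧-elim {into?} rest)))
    injective : ∀ i j → lookup φ i ≡ lookup φ j → i ≡ j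
    injective i j eq with i ≟F j | allF⁻ (allF⁻ inj i) j
    ... | yes i≡j | _     = i≡j
    ... | no _    | φi≢φj = ⊥-elim (not-elim φi≢φj (fromWitness eq))
    onto : ∀ v → T (B v) → ∃ λ i → lookup φ i ≡ v
    onto v Bv = let i , φi≡v = anyF⁻ (⇒-elim (allF⁻ onto′ v) Bv) in i , toWitness φi≡v

  inA⁺ : ∀ {B} → InducedCopy A g B → T (inA A g B)
  inA⁺ {B} c = any-∈ _ (∈-allVecs φ)
    (∧-intro (allF⁺ λ i → allF⁺ λ j → injective′ i j)
    (∧-intro (allF⁺ into)
    (∧-intro (allF⁺ onto′)
    member)))
    where
    open InducedCopy c
    onto′ : ∀ v → T (not (B v) ∨ anyF d (λ i → ⌊ lookup φ i ≟F v ⌋))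
    onto′ v = ⇒-intro λ Bv → let i , φi≡v = onto v Bv in anyF⁺ i (fromWitness φi≡v)
    injective′ : ∀ i j → T (⌊ i ≟F j ⌋ ∨ not ⌊ lookup φ i ≟F lookup φ j ⌋)
    injective′ i j with i ≟F j
    ... | yes _  = _
    ... | no i≢j = not-intro (λ t → i≢j (injective i j (toWitness t)))

  inA-cong : ∀ {B B′} → (∀ v → B v ≡ B′ v) → inA A g B ≡ inA A g B′
  inA-cong {B} {B′} B≗B′ = T-ext (inA⁺ ∘ transport B≗B′ ∘ inA⁻) (inA⁺ ∘ transport (sym ∘ B≗B′) ∘ inA⁻)
    where
    transport : ∀ {C C′} → (∀ v → C v ≡ C′ v) → InducedCopy A g C → InducedCopy A g C′
    transport C≗C′ c = record
      { φ = φ ; injective = injective ; into = λ i → subst T (C≗C′ _) (into i)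
      ; onto = λ v → onto v ∘ subst T (sym (C≗C′ v)) ; member = member }
      where open InducedCopy c

  card-inA : ∀ {B} → T (inA A g B) → card n B ≡ d
  card-inA {B} t = sym (trans (sym card-all)
    (count-bijection _≟F_ _≟F_ (λ _ → true) B (lookup φ) (allFin d) (allFin n)
      (λ i _ → occursOnce-allFin i) (λ v _ → occursOnce-allFin v) (λ i _ → into i)
      (λ i j _ _ → injective i j) (λ v Bv → let i , φi≡v = onto v Bv in i , _ , φi≡v)))
    where open InducedCopy (inA⁻ t)

  inA⇒d≤n : ∀ {B} → T (inA A g B) → d ≤ n
  inA⇒d≤n {B} t = subst₂ _≤_ (card-inA t) card-all (count-mono (λ _ _ → _) (allFin n))

  inA-connected : (∀ h → T (A h) → Connected h) → ∀ {B} → T (inA A g B)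
    → ∀ {u v} → T (B u) → T (B v) → T (reachB g B d u v)
  inA-connected connected {B} t Bu Bv =
    let i , φi≡u = onto _ Bu ; j , φj≡v = onto _ Bv in
    subst₂ (λ u v → T (reachB g B d u v)) φi≡u φj≡v
      (reachB-pullback g φ into d (Equivalence.from T-≡ (proj₂ (connected _ member) i j)))
    where open InducedCopy (inA⁻ t)

  zetaA⁻ : ∀ {B} → T (zetaA A g B) → ∀ v → T (B v) → T (inA A g (component g B v))
  zetaA⁻ t v = ⇒-elim (allF⁻ t v)

  zetaA⁺ : ∀ {B} → (∀ v → T (B v) → T (inA A g (component g B v))) → T (zetaA A g B)
  zetaA⁺ h = allF⁺ λ v → ⇒-intro (h v)

  zetaA-cong : ∀ {B B′} → (∀ v → B v ≡ B′ v) → zetaA A g B ≡ zetaA A g B′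
  zetaA-cong {B} {B′} B≗B′ = T-ext (λ t → zetaA⁺ λ v B′v → subst T (inA-cong (components v))
                                             (zetaA⁻ t v (subst T (sym (B≗B′ v)) B′v)))
                                  (λ t → zetaA⁺ λ v Bv → subst T (sym (inA-cong (components v)))
                                             (zetaA⁻ t v (subst T (B≗B′ v) Bv)))
    where
    components : ∀ v x → component g B v x ≡ component g B′ v x
    components v x = cong₂ _∧_ (B≗B′ x) (reachB-cong g B≗B′ n v x)

module _ {ℓ n : ℕ} (g : Graph n) (f : Vec (Fin ℓ) n) where

  adj-quotient : ∀ a b → adj (quotient g f) a b
    ≡ not ⌊ a ≟F b ⌋ ∧ anyF n (λ u → anyF n (λ v → ⌊ lookup f u ≟F a ⌋ ∧ ⌊ lookup f v ≟F b ⌋ ∧ adj g u v))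
  adj-quotient a b = trans (cong (λ row → lookup row b) (Vec.lookup∘tabulate _ a)) (Vec.lookup∘tabulate _ b)

  quotient-edge⁺ : ∀ {u v} → lookup f u ≢ lookup f v → T (adj g u v) → T (adj (quotient g f) (lookup f u) (lookup f v))
  quotient-edge⁺ {u} {v} fu≢fv uv = subst T (sym (adj-quotient _ _))
    (∧-intro (not-intro (fu≢fv ∘ toWitness)) (anyF⁺ u (anyF⁺ v edge)))
    where
    edge : T (⌊ lookup f u ≟F lookup f u ⌋ ∧ ⌊ lookup f v ≟F lookup f v ⌋ ∧ adj g u v)
    edge = ∧-intro (⌊≟⌋-refl _≟F_ (lookup f u)) (∧-intro (⌊≟⌋-refl _≟F_ (lookup f v)) uv)

  quotient-edge⁻ : ∀ {a b} → T (adj (quotient g f) a b)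
    → a ≢ b × ∃ λ u → ∃ λ v → lookup f u ≡ a × lookup f v ≡ b × T (adj g u v)
  quotient-edge⁻ {a} {b} t with a ≟F b | subst T (adj-quotient a b) t
  ... | no a≢b | edge with anyF⁻ edge
  ... | u , edge′ with anyF⁻ edge′
  ... | v , e with lookup f u ≟F a | lookup f v ≟F b | e
  ... | yes fu≡a | yes fv≡b | uv = a≢b , u , v , fu≡a , fv≡b , uv

-- Set partitions as restricted growth labellings

record SetPartition {ℓ n : ℕ} (f : Vec (Fin ℓ) n) : Set where
  field
    surjective : ∀ a → ∃ λ v → lookup f v ≡ a
    growth     : ∀ v a → toℕ a < toℕ (lookup f v) → ∃ λ u → toℕ u < toℕ v × lookup f u ≡ a

module _ {ℓ n : ℕ} {f : Vec (Fin ℓ) n} where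

  isSetPartition⁻ : T (isSetPartition f) → SetPartition f
  isSetPartition⁻ t = record { surjective = surjective ; growth = growth }
    where
    surjective? = allF ℓ (λ a → anyF n (λ v → ⌊ lookup f v ≟F a ⌋))
    parts = ∧-elim {surjective?} t
    surjective : ∀ a → ∃ λ v → lookup f v ≡ a
    surjective a = let v , fv≡a = anyF⁻ (allF⁻ (proj₁ parts) a) in v , toWitness fv≡a
    growth : ∀ v a → toℕ a < toℕ (lookup f v) → ∃ λ u → toℕ u < toℕ v × lookup f u ≡ a
    growth v a a<fv with anyF⁻ (⇒-elim (allF⁻ (allF⁻ (proj₂ parts) v) a) (<⇒<ᵇ a<fv))
    ... | u , t′ = let u<v , fu≡a = ∧-elim {toℕ u <ᵇ toℕ v} t′ in u , <ᵇ⇒< _ _ u<v , toWitness fu≡a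

  isSetPartition⁺ : SetPartition f → T (isSetPartition f)
  isSetPartition⁺ P = ∧-intro (allF⁺ surjective′) (allF⁺ λ v → allF⁺ λ a → ⇒-intro (growth′ v a))
    where
    open SetPartition P
    surjective′ : ∀ a → T (anyF n (λ v → ⌊ lookup f v ≟F a ⌋))
    surjective′ a = let v , fv≡a = surjective a in anyF⁺ v (fromWitness fv≡a)
    growth′ : ∀ v a → T (toℕ a <ᵇ toℕ (lookup f v))
      → T (anyF n (λ u → (toℕ u <ᵇ toℕ v) ∧ ⌊ lookup f u ≟F a ⌋))
    growth′ v a a<fv = let u , u<v , fu≡a = growth v a (<ᵇ⇒< _ _ a<fv) in
      anyF⁺ u (∧-intro (<⇒<ᵇ u<v) (fromWitness fu≡a))

  #blocks≤n : SetPartition f → ℓ ≤ n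
  #blocks≤n P = Fin.injective⇒≤ {f = proj₁ ∘ surjective} λ {a} {b} eq →
    trans (sym (proj₂ (surjective a))) (trans (cong (lookup f) eq) (proj₂ (surjective b)))
    where open SetPartition P

SameKernel : {X Y : Set} {n : ℕ} → (Fin n → X) → (Fin n → Y) → Set
SameKernel r s = ∀ u v → r u ≡ r v ⇔ s u ≡ s v

module _ {ℓ ℓ′ n : ℕ} (f : Vec (Fin ℓ) n) (f′ : Vec (Fin ℓ′) n) where

  label-≤-at-first : SetPartition f′ → ∀ v
    → (∀ u → toℕ u < toℕ v → toℕ (lookup f u) ≡ toℕ (lookup f′ u))
    → (∀ u → toℕ u < toℕ v → lookup f u ≢ lookup f v)
    → toℕ (lookup f′ v) ≤ toℕ (lookup f v)
  label-≤-at-first P′ v agree first = ≮⇒≥ λ fv<f′v →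
    let a′ = fromℕ< (<-trans fv<f′v (Fin.toℕ<n (lookup f′ v)))
        u , u<v , f′u≡a′ = SetPartition.growth P′ v a′ (subst (_< _) (sym (Fin.toℕ-fromℕ< _)) fv<f′v)
    in first u u<v (Fin.toℕ-injective (trans (agree u u<v) (trans (cong toℕ f′u≡a′) (Fin.toℕ-fromℕ< _))))

  #blocks-≤ : SetPartition f′ → (∀ v → toℕ (lookup f v) ≡ toℕ (lookup f′ v)) → ℓ′ ≤ ℓ
  #blocks-≤ P′ agree = ≮⇒≥ λ ℓ<ℓ′ →
    let v , f′v≡ℓ = SetPartition.surjective P′ (fromℕ< ℓ<ℓ′)
    in <-irrefl (trans (agree v) (trans (cong toℕ f′v≡ℓ) (Fin.toℕ-fromℕ< ℓ<ℓ′))) (Fin.toℕ<n (lookup f v))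

module _ {ℓ ℓ′ n : ℕ} {f : Vec (Fin ℓ) n} {f′ : Vec (Fin ℓ′) n}
         (P : SetPartition f) (P′ : SetPartition f′) (kernel : SameKernel (lookup f) (lookup f′)) where

  labels-agree : ∀ v → toℕ (lookup f v) ≡ toℕ (lookup f′ v)
  labels-agree = WF.All.wfRec <-wellFounded 0ℓ (λ v → toℕ (lookup f v) ≡ toℕ (lookup f′ v)) step
    where
    step : ∀ v → (∀ {u} → toℕ u < toℕ v → toℕ (lookup f u) ≡ toℕ (lookup f′ u))
      → toℕ (lookup f v) ≡ toℕ (lookup f′ v)
    step v IH with Fin.any? (λ u → (u Fin.<? v) ×-dec (lookup f u ≟F lookup f v))
    ... | yes (u , u<v , fu≡fv) =
      trans (cong toℕ (sym fu≡fv)) (trans (IH u<v) (cong toℕ (Equivalence.to (kernel u v) fu≡fv)))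
    ... | no no-earlier = ≤-antisym
      (label-≤-at-first f′ f P v (λ u u<v → sym (IH u<v)) λ u u<v f′u≡f′v →
        no-earlier (u , u<v , Equivalence.from (kernel u v) f′u≡f′v))
      (label-≤-at-first f f′ P′ v (λ u → IH) (λ u u<v fu≡fv → no-earlier (u , u<v , fu≡fv)))

  setPartition-unique : _≡_ {A = Σ ℕ λ k → Vec (Fin k) n} (ℓ , f) (ℓ′ , f′)
  setPartition-unique with ≤-antisym (#blocks-≤ f′ f P (sym ∘ labels-agree)) (#blocks-≤ f f′ P′ labels-agree)
  ... | refl = cong (ℓ ,_) (lookup-ext f f′ (Fin.toℕ-injective ∘ labels-agree))

record KernelPartition {X : Set} {n : ℕ} (r : Fin n → X) : Set where
  field
    #blocks   : ℕ
    labelling : Vec (Fin #blocks) n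
    partition : SetPartition labelling
    kernel    : SameKernel (lookup labelling) r

module _ {X : Set} (_≟X_ : DecidableEquality X) {n : ℕ} (r : Fin n → X) where
  private
    firstWitness : ∀ v → ∃ λ m → r m ≡ r v × ∀ u → toℕ u < toℕ m → r u ≢ r v
    firstWitness v with Fin.¬∀⟶∃¬-smallest n (λ u → r u ≢ r v) (λ u → ¬? (r u ≟X r v)) (λ all → all v refl)
    ... | m , ¬≢ , below = m , decidable-stable (r m ≟X r v) ¬≢ , λ u u<m →
      subst (λ w → r w ≢ r v) (Fin.toℕ-injective (trans (Fin.toℕ-inject (fromℕ< u<m)) (Fin.toℕ-fromℕ< u<m)))
            (below (fromℕ< u<m))

    first : Fin n → Fin n
    first v = proj₁ (firstWitness v)

    r-first : ∀ v → r (first v) ≡ r v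
    r-first v = proj₁ (proj₂ (firstWitness v))

    first-minimal : ∀ v u → toℕ u < toℕ (first v) → r u ≢ r v
    first-minimal v = proj₂ (proj₂ (firstWitness v))

    first-≤ : ∀ v → toℕ (first v) ≤ toℕ v
    first-≤ v = ≮⇒≥ λ v<first → first-minimal v v v<first refl

    first-cong : ∀ {u v} → r u ≡ r v → first u ≡ first v
    first-cong {u} {v} ru≡rv with <-cmp (toℕ (first u)) (toℕ (first v))
    ... | tri≈ _ eq _ = Fin.toℕ-injective eq
    ... | tri< lt _ _ = ⊥-elim (first-minimal v (first u) lt (trans (r-first u) ru≡rv))
    ... | tri> _ _ gt = ⊥-elim (first-minimal u (first v) gt (trans (r-first v) (sym ru≡rv)))

    first-idem : ∀ v → first (first v) ≡ first v
    first-idem v = first-cong (r-first v)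

    isFirstAt : ℕ → Bool
    isFirstAt t = anyF n (λ w → ⌊ toℕ w ≟ t ⌋ ∧ ⌊ first w ≟F w ⌋)

    isFirstAt⁺ : ∀ w → first w ≡ w → T (isFirstAt (toℕ w))
    isFirstAt⁺ w fw≡w = anyF⁺ w (∧-intro (⌊≟⌋-refl _≟_ (toℕ w)) (fromWitness fw≡w))

    isFirstAt⁻ : ∀ {t} → T (isFirstAt t) → ∃ λ w → toℕ w ≡ t × first w ≡ w
    isFirstAt⁻ {t} x with anyF⁻ x
    ... | w , y with toℕ w ≟ t | first w ≟F w | y
    ... | yes wt | yes fw≡w | _ = w , wt , fw≡w

    -- the number of blocks whose least element is below t
    #firsts : ℕ → ℕ
    #firsts zero    = 0
    #firsts (suc t) = #firsts t + 𝟙 (isFirstAt t)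

    #firsts-mono : ∀ {t t′} → t ≤ t′ → #firsts t ≤ #firsts t′
    #firsts-mono t≤t′ = go (≤⇒≤′ t≤t′)
      where
      go : ∀ {t t′} → t ≤′ t′ → #firsts t ≤ #firsts t′
      go ≤′-refl         = ≤-refl
      go (≤′-step {t′} p) = ≤-trans (go p) (m≤m+n (#firsts t′) _)

    #firsts-at-first : ∀ w → first w ≡ w → #firsts (suc (toℕ w)) ≡ suc (#firsts (toℕ w))
    #firsts-at-first w fw≡w with isFirstAt (toℕ w) | isFirstAt⁺ w fw≡w
    ... | true | _ = +-comm (#firsts (toℕ w)) 1

    #firsts-reaches : ∀ a t → a < #firsts t → ∃ λ w → toℕ w < t × first w ≡ w × #firsts (toℕ w) ≡ a
    #firsts-reaches a (suc t) a< with a <? #firsts t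
    ... | yes a<t = let w , w<t , fw≡w , eq = #firsts-reaches a t a<t in w , m<n⇒m<1+n w<t , fw≡w , eq
    ... | no a≮t with isFirstAt t in firstAt | a<
    ... | false | a<′ = ⊥-elim (a≮t (subst (a <_) (+-identityʳ _) a<′))
    ... | true  | a<′ = let w , w≡t , fw≡w = isFirstAt⁻ (subst T (sym firstAt) _) in
      w , subst (_< suc t) (sym w≡t) ≤-refl , fw≡w ,
      trans (cong #firsts w≡t) (≤-antisym (≮⇒≥ a≮t) (m<1+n⇒m≤n (subst (a <_) (+-comm (#firsts t) 1) a<′)))

    label : Fin n → ℕ
    label v = #firsts (toℕ (first v))

    label<#firsts : ∀ v {t} → toℕ (first v) < t → label v < #firsts t
    label<#firsts v lt = ≤-trans (≤-reflexive (sym (#firsts-at-first (first v) (first-idem v)))) (#firsts-mono lt)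

    labelling : Vec (Fin (#firsts n)) n
    labelling = tabulate λ v → fromℕ< (label<#firsts v (Fin.toℕ<n (first v)))

    toℕ-labelling : ∀ v → toℕ (lookup labelling v) ≡ label v
    toℕ-labelling v = trans (cong toℕ (Vec.lookup∘tabulate _ v)) (Fin.toℕ-fromℕ< _)

    label-first : ∀ w → first w ≡ w → label w ≡ #firsts (toℕ w)
    label-first w fw≡w = cong (#firsts ∘ toℕ) fw≡w

    labelling-kernel : SameKernel (lookup labelling) r
    labelling-kernel u v = mk⇔ to from
      where
      to : lookup labelling u ≡ lookup labelling v → r u ≡ r v
      to eq = trans (sym (r-first u)) (trans (cong r first-u≡first-v) (r-first v))
        where
        labels : label u ≡ label v
        labels = trans (sym (toℕ-labelling u)) (trans (cong toℕ eq) (toℕ-labelling v))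
        first-u≡first-v : first u ≡ first v
        first-u≡first-v with <-cmp (toℕ (first u)) (toℕ (first v))
        ... | tri≈ _ e _ = Fin.toℕ-injective e
        ... | tri< lt _ _ = ⊥-elim (<-irrefl labels (label<#firsts u lt))
        ... | tri> _ _ gt = ⊥-elim (<-irrefl (sym labels) (label<#firsts v gt))
      from : r u ≡ r v → lookup labelling u ≡ lookup labelling v
      from ru≡rv = Fin.toℕ-injective (trans (toℕ-labelling u)
                     (trans (cong (#firsts ∘ toℕ) (first-cong ru≡rv)) (sym (toℕ-labelling v))))

    labelling-partition : SetPartition labelling
    labelling-partition = record { surjective = surjective ; growth = growth }
      where
      hit : ∀ a {w} → first w ≡ w → #firsts (toℕ w) ≡ toℕ a → lookup labelling w ≡ a
      hit a {w} fw≡w eq = Fin.toℕ-injective (trans (toℕ-labelling w) (trans (label-first w fw≡w) eq))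
      surjective : ∀ a → ∃ λ v → lookup labelling v ≡ a
      surjective a = let w , _ , fw≡w , eq = #firsts-reaches (toℕ a) n (Fin.toℕ<n a) in w , hit a fw≡w eq
      growth : ∀ v a → toℕ a < toℕ (lookup labelling v) → ∃ λ u → toℕ u < toℕ v × lookup labelling u ≡ a
      growth v a a< =
        let w , w<first , fw≡w , eq = #firsts-reaches (toℕ a) (toℕ (first v)) (subst (toℕ a <_) (toℕ-labelling v) a<)
        in w , <-≤-trans w<first (first-≤ v) , hit a fw≡w eq

  -- Abstract: only the fields are used, and unfolding the labelling is prohibitively expensive.
  abstract
    kernelPartition : KernelPartition r
    kernelPartition = record
      { #blocks = #firsts n ; labelling = labelling ; partition = labelling-partition ; kernel = labelling-kernel }

-- Triples (π, κ) and the labellings κ ∘ π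

module _ {d n : ℕ} (A : Graph d → Bool) (g : Graph n) where

  admissible : (α : List ℕ) → Vec (Fin (length α)) n → Bool
  admissible α G = allF (length α) (λ i → (card n (block G i) ≡ᵇ List.lookup α i) ∧ zetaA A g (block G i))

  record Admissible (α : List ℕ) (G : Vec (Fin (length α)) n) : Set where
    field
      size : ∀ i → card n (block G i) ≡ List.lookup α i
      zeta : ∀ i → T (zetaA A g (block G i))

  admissible⁻ : ∀ {α G} → T (admissible α G) → Admissible α G
  admissible⁻ {α} {G} t = record
    { size = λ i → ≡ᵇ⇒≡ _ _ (proj₁ (∧-elim {card n (block G i) ≡ᵇ _} (allF⁻ t i)))
    ; zeta = λ i → proj₂ (∧-elim {card n (block G i) ≡ᵇ _} (allF⁻ t i)) }

  admissible⁺ : ∀ {α G} → Admissible α G → T (admissible α G)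
  admissible⁺ a = allF⁺ λ i → ∧-intro (≡⇒≡ᵇ _ _ (size i)) (zeta i)
    where open Admissible a

  module _ (e : List ℕ) where

    properColouring : ∀ {ℓ} → Graph ℓ → Vec (Fin (length e)) ℓ → Bool
    properColouring {ℓ} h κ =
      allF ℓ (λ a → allF ℓ (λ b → not (adj h a b) ∨ not ⌊ lookup κ a ≟F lookup κ b ⌋))
      ∧ allF (length e) (λ i → (d * card ℓ (λ a → ⌊ lookup κ a ≟F i ⌋)) ≡ᵇ List.lookup e i)

    Triple : Set
    Triple = Σ ℕ λ ℓ → Vec (Fin ℓ) n × Vec (Fin (length e)) ℓ

    isValid : Triple → Bool
    isValid (ℓ , f , κ) = inPiA A g f ∧ properColouring (quotient g f) κ

    pairs : (ℓ : ℕ) → List (Vec (Fin ℓ) n × Vec (Fin (length e)) ℓ)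
    pairs ℓ = dependentProduct (allVecs ℓ n) λ _ → allVecs (length e) ℓ

    triples : List Triple
    triples = dependentProduct (upTo (suc n)) pairs

    coeffRHS≡count-valid : coeffRHS A g e ≡ count isValid triples
    coeffRHS≡count-valid = sym (trans (count-dependentProduct isValid (upTo (suc n)) pairs)
                                      (cong sum (List.map-cong per-ℓ (upTo (suc n)))))
      where
      per-ℓ : ∀ ℓ → count (isValid ∘ (ℓ ,_)) (pairs ℓ)
                  ≡ sum (map (λ f → if inPiA A g f then coeffXd (quotient g f) d e else 0) (allVecs ℓ n))
      per-ℓ ℓ = trans (count-dependentProduct (isValid ∘ (ℓ ,_)) (allVecs ℓ n) (λ _ → allVecs (length e) ℓ))
                      (cong sum (List.map-cong (λ f → count-∧ˡ (inPiA A g f) _ (allVecs (length e) ℓ)) (allVecs ℓ n)))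

    _≟T_ : DecidableEquality Triple
    _≟T_ = Product.≡-dec _≟_ (Product.≡-dec _≟V_ _≟V_)

    occursOnce-triples : ∀ {ℓ f κ} → ℓ ≤ n → OccursOnce _≟T_ (ℓ , f , κ) triples
    occursOnce-triples {ℓ} {f} {κ} ℓ≤n =
      occursOnce-dependentProduct _≟_ (Product.≡-dec _≟V_ _≟V_) {xs = upTo (suc n)}
        {ys = pairs} (occursOnce-upTo (s≤s ℓ≤n))
        (occursOnce-dependentProduct _≟V_ _≟V_ {xs = allVecs ℓ n} {ys = λ _ → allVecs (length e) ℓ}
          (occursOnce-allVecs ℓ n f) (occursOnce-allVecs (length e) ℓ κ))

    record Valid (t : Triple) : Set where
      private
        ℓ = proj₁ t
        f = proj₁ (proj₂ t)
        κ = proj₂ (proj₂ t)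
      field
        partition : SetPartition f
        blocks    : ∀ a → T (inA A g (block f a))
        proper    : ∀ a b → T (adj (quotient g f) a b) → lookup κ a ≢ lookup κ b
        sizes     : ∀ i → d * card ℓ (λ a → ⌊ lookup κ a ≟F i ⌋) ≡ List.lookup e i

    valid⁻ : ∀ t → T (isValid t) → Valid t
    valid⁻ (ℓ , f , κ) t = record
      { partition = isSetPartition⁻ (proj₁ (∧-elim {isSetPartition f} inΠ))
      ; blocks = allF⁻ (proj₂ (∧-elim {isSetPartition f} inΠ))
      ; proper = λ a b ab κa≡κb → not-elim (⇒-elim (allF⁻ (allF⁻ (proj₁ colouring) a) b) ab) (fromWitness κa≡κb)
      ; sizes = λ i → ≡ᵇ⇒≡ _ _ (allF⁻ (proj₂ colouring) i) }
      where
      inΠ = proj₁ (∧-elim {inPiA A g f} t)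
      proper? = allF ℓ (λ a → allF ℓ (λ b → not (adj (quotient g f) a b) ∨ not ⌊ lookup κ a ≟F lookup κ b ⌋))
      colouring = ∧-elim {proper?} (proj₂ (∧-elim {inPiA A g f} t))

    valid⁺ : ∀ t → Valid t → T (isValid t)
    valid⁺ (ℓ , f , κ) v = ∧-intro (∧-intro (isSetPartition⁺ partition) (allF⁺ blocks))
      (∧-intro (allF⁺ λ a → allF⁺ λ b → ⇒-intro λ ab → not-intro (proper a b ab ∘ toWitness))
               (allF⁺ λ i → ≡⇒≡ᵇ _ _ (sizes i)))
      where open Valid v

    valid⇒d∣n : ∀ t → Valid t → d ∣ n
    valid⇒d∣n (ℓ , f , κ) V = divides ℓ (card-uniform-blocks (lookup f) (λ a → card-inA A g (Valid.blocks V a)))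

    coeffRHS≡0 : ¬ d ∣ n → coeffRHS A g e ≡ 0
    coeffRHS≡0 d∤n = trans coeffRHS≡count-valid (count-none triples λ t vt → d∤n (valid⇒d∣n t (valid⁻ t vt)))

    triple-≡ : ∀ {ℓ ℓ′} {f : Vec (Fin ℓ) n} {f′ : Vec (Fin ℓ′) n} {κ κ′} → SetPartition f
      → _≡_ {A = Σ ℕ λ k → Vec (Fin k) n} (ℓ , f) (ℓ′ , f′)
      → (∀ v → lookup κ (lookup f v) ≡ lookup κ′ (lookup f′ v)) → _≡_ {A = Triple} (ℓ , f , κ) (ℓ′ , f′ , κ′)
    triple-≡ {f = f} {κ = κ} {κ′} P refl same = cong (λ κ → _ , f , κ) (lookup-ext κ κ′ λ a →
      let v , fv≡a = SetPartition.surjective P a in subst (λ b → lookup κ b ≡ lookup κ′ b) fv≡a (same v))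

    compose : Triple → Vec (Fin (length e)) n
    compose (ℓ , f , κ) = Vec.map (lookup κ) f

    module _ (connected : ∀ h → T (A h) → Connected h) where

      block-walk : ∀ {ℓ} (f : Vec (Fin ℓ) n) → (∀ a → T (inA A g (block f a)))
        → ∀ {u v} → lookup f u ≡ lookup f v → T (reachB g (block f (lookup f v)) n v u)
      block-walk f blocks {u} {v} fu≡fv = reachB-mono g (inA⇒d≤n A g (blocks (lookup f v)))
        (inA-connected A g connected (blocks _) (⌊≟⌋-refl _≟F_ (lookup f v)) (fromWitness fu≡fv))

      -- Leaving the block of v would use an edge of the quotient whose ends κ colours equally.
      walk-preserves-label : ∀ {ℓ} (f : Vec (Fin ℓ) n) (κ : Vec (Fin (length e)) ℓ)
        → (∀ a b → T (adj (quotient g f) a b) → lookup κ a ≢ lookup κ b)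
        → (B : Fin n → Bool) → (∀ x y → T (B x) → T (B y) → lookup κ (lookup f x) ≡ lookup κ (lookup f y))
        → ∀ m {v u} → T (B v) → T (reachB g B m v u) → lookup f u ≡ lookup f v
      walk-preserves-label f κ proper B constant m {v} Bv walk =
        proj₂ (reachB-invariant g (λ x → T (B x) × lookup f x ≡ lookup f v) step m (Bv , refl) walk)
        where
        step : ∀ w x → T (B w) × lookup f w ≡ lookup f v → T (B x) → T (adj g w x) → T (B x) × lookup f x ≡ lookup f v
        step w x (Bw , fw≡fv) Bx wx with lookup f w ≟F lookup f x
        ... | yes fw≡fx = Bx , trans (sym fw≡fx) fw≡fv
        ... | no fw≢fx  = ⊥-elim (proper _ _ (quotient-edge⁺ g f fw≢fx wx) (constant w x Bw Bx))

      lookup-compose : ∀ {ℓ} (f : Vec (Fin ℓ) n) κ v → lookup (compose (ℓ , f , κ)) v ≡ lookup κ (lookup f v)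
      lookup-compose f κ v = Vec.lookup-map v (lookup κ) f

      valid⇒admissible : ∀ t → Valid t → Admissible e (compose t)
      valid⇒admissible (ℓ , f , κ) V = record { size = size ; zeta = zeta }
        where
        open Valid V
        G = compose (ℓ , f , κ)
        colour : ∀ {x i} → T (block G i x) → lookup κ (lookup f x) ≡ i
        colour {x} Gx = trans (sym (lookup-compose f κ x)) (toWitness Gx)
        size : ∀ i → card n (block G i) ≡ List.lookup e i
        size i = begin
          card n (block G i)
            ≡⟨ count-cong (λ v → cong (λ c → ⌊ c ≟F i ⌋) (lookup-compose f κ v)) (allFin n) ⟩
          card n (λ v → ⌊ lookup κ (lookup f v) ≟F i ⌋)
            ≡⟨ card-∘ (lookup f) (lookup κ) (λ a → card-inA A g (blocks a)) i ⟩
          d * card ℓ (λ a → ⌊ lookup κ a ≟F i ⌋)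
            ≡⟨ sizes i ⟩
          List.lookup e i ∎
          where open ≡-Reasoning
        component≡block : ∀ i v → T (block G i v) → ∀ x → component g (block G i) v x ≡ block f (lookup f v) x
        component≡block i v Gv x = T-ext
          (λ c → let Gx , walk = ∧-elim {block G i x} c in
            fromWitness (walk-preserves-label f κ proper (block G i)
                           (λ y z Gy Gz → trans (colour Gy) (sym (colour Gz))) n Gv walk))
          (λ fx → let fx≡fv = toWitness fx in
            ∧-intro (fromWitness (trans (lookup-compose f κ x) (trans (cong (lookup κ) fx≡fv) (colour Gv))))
                    (reachB-⊆ g (λ y fy → fromWitness (trans (lookup-compose f κ y)
                                   (trans (cong (lookup κ) (toWitness fy)) (colour Gv))))
                              n (block-walk f blocks fx≡fv)))
        zeta : ∀ i → T (zetaA A g (block G i))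
        zeta i = zetaA⁺ A g λ v Gv → subst T (sym (inA-cong A g (component≡block i v Gv))) (blocks (lookup f v))

      colour-agrees : ∀ {ℓ ℓ′} (f : Vec (Fin ℓ) n) (f′ : Vec (Fin ℓ′) n) κ κ′
        → compose (ℓ , f , κ) ≡ compose (ℓ′ , f′ , κ′)
        → ∀ v → lookup κ (lookup f v) ≡ lookup κ′ (lookup f′ v)
      colour-agrees f f′ κ κ′ eq v =
        trans (sym (lookup-compose f κ v)) (trans (cong (λ G → lookup G v) eq) (lookup-compose f′ κ′ v))

      -- Each block of f is connected and κ′ ∘ f′ is constant on it.
      refines : ∀ {ℓ ℓ′} {f : Vec (Fin ℓ) n} {f′ : Vec (Fin ℓ′) n} {κ κ′}
        → Valid (ℓ , f , κ) → Valid (ℓ′ , f′ , κ′)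
        → (∀ v → lookup κ (lookup f v) ≡ lookup κ′ (lookup f′ v))
        → ∀ {u v} → lookup f u ≡ lookup f v → lookup f′ u ≡ lookup f′ v
      refines {f = f} {f′} {κ} {κ′} V V′ same {u} {v} fu≡fv =
        walk-preserves-label f′ κ′ (Valid.proper V′) (block f (lookup f v)) constant n
          (⌊≟⌋-refl _≟F_ (lookup f v)) (block-walk f (Valid.blocks V) fu≡fv)
        where
        constant : ∀ x y → T (block f (lookup f v) x) → T (block f (lookup f v) y)
          → lookup κ′ (lookup f′ x) ≡ lookup κ′ (lookup f′ y)
        constant x y fx fy = trans (sym (same x)) (trans (cong (lookup κ) (trans (toWitness fx) (sym (toWitness fy)))) (same y))

      compose-injective : ∀ t t′ → Valid t → Valid t′ → compose t ≡ compose t′ → t ≡ t′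
      compose-injective (ℓ , f , κ) (ℓ′ , f′ , κ′) V V′ eq = triple-≡ (Valid.partition V) same-partition same-colour
        where
        same-colour = colour-agrees f f′ κ κ′ eq
        same-partition = setPartition-unique (Valid.partition V) (Valid.partition V′)
          (λ u v → mk⇔ (refines V V′ same-colour) (refines V′ V (sym ∘ same-colour)))

      module Decompose (G : Vec (Fin (length e)) n) (adm : Admissible e G) where
        open Admissible adm

        colourClass : Fin n → Fin n → Bool
        colourClass u = block G (lookup G u)

        piece : Fin n → Fin n → Bool
        piece u = component g (colourClass u) u

        piece-inA : ∀ u → T (inA A g (piece u))
        piece-inA u = zetaA⁻ A g (zeta (lookup G u)) u (⌊≟⌋-refl _≟F_ (lookup G u))

        piece-self : ∀ u → T (piece u u)
        piece-self u = ∧-intro (⌊≟⌋-refl _≟F_ (lookup G u)) (reachB-refl g _ n u)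

        piece-colour : ∀ {u x} → T (piece u x) → lookup G x ≡ lookup G u
        piece-colour {u} {x} p = toWitness (proj₁ (∧-elim {colourClass u x} p))

        piece-⊆ : ∀ {u v} → T (piece u v) → ∀ x → T (piece u x) → T (piece v x)
        piece-⊆ {u} {v} uv x ux = ∧-intro (fromWitness (trans (piece-colour ux) (sym (piece-colour uv))))
          (reachB-mono g (inA⇒d≤n A g (piece-inA u))
            (reachB-⊆ g (λ y uy → fromWitness (trans (piece-colour uy) (sym (piece-colour uv)))) d
              (inA-connected A g connected (piece-inA u) uv ux)))

        -- Both pieces have exactly d vertices, so the inclusion is an equality.
        piece-≡ : ∀ {u v} → T (piece u v) → ∀ x → piece v x ≡ piece u x
        piece-≡ {u} {v} uv x = T-ext
          (⊆-card-≡⇒⊇ (piece u) (piece v) (piece-⊆ uv) (trans (card-inA A g (piece-inA u)) (sym (card-inA A g (piece-inA v)))) x)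
          (piece-⊆ uv x)

        pieceVector : Fin n → Vec Bool n
        pieceVector u = tabulate (piece u)

        pieceVector-≡ : ∀ u v → pieceVector u ≡ pieceVector v ⇔ T (piece u v)
        pieceVector-≡ u v = mk⇔
          (λ eq → subst T (trans (cong (λ w → lookup w v) (sym eq)) (Vec.lookup∘tabulate (piece u) v))
                          (subst T (sym (Vec.lookup∘tabulate (piece v) v)) (piece-self v)))
          (λ uv → sym (Vec.tabulate-cong (piece-≡ uv)))

        open KernelPartition (kernelPartition (Vec.≡-dec _≟B_) pieceVector)
          renaming (#blocks to ℓ; labelling to f)

        block≡piece : ∀ u x → block f (lookup f u) x ≡ piece u x
        block≡piece u x = T-ext
          (λ fx → Equivalence.to (pieceVector-≡ u x) (sym (Equivalence.to (kernel x u) (toWitness fx))))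
          (λ ux → fromWitness (Equivalence.from (kernel x u) (sym (Equivalence.from (pieceVector-≡ u x) ux))))

        representative : Fin ℓ → Fin n
        representative a = proj₁ (SetPartition.surjective partition a)

        f-representative : ∀ a → lookup f (representative a) ≡ a
        f-representative a = proj₂ (SetPartition.surjective partition a)

        blocks : ∀ a → T (inA A g (block f a))
        blocks a = subst (λ b → T (inA A g (block f b))) (f-representative a)
          (subst T (sym (inA-cong A g (block≡piece (representative a)))) (piece-inA (representative a)))

        κ : Vec (Fin (length e)) ℓ
        κ = tabulate (lookup G ∘ representative)

        κ∘f : ∀ v → lookup κ (lookup f v) ≡ lookup G v
        κ∘f v = trans (Vec.lookup∘tabulate _ (lookup f v)) (piece-colour (subst T (block≡piece v _)
                  (fromWitness (f-representative (lookup f v)))))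

        proper : ∀ a b → T (adj (quotient g f) a b) → lookup κ a ≢ lookup κ b
        proper a b ab κa≡κb = a≢b (trans (sym fu≡a) (trans (sym fv≡fu) fv≡b))
          where
          edge : a ≢ b × ∃ λ u → ∃ λ v → lookup f u ≡ a × lookup f v ≡ b × T (adj g u v)
          edge = quotient-edge⁻ g f ab
          a≢b = proj₁ edge
          u v : Fin n
          u = proj₁ (proj₂ edge)
          v = proj₁ (proj₂ (proj₂ edge))
          fu≡a : lookup f u ≡ a
          fu≡a = proj₁ (proj₂ (proj₂ (proj₂ edge)))
          fv≡b : lookup f v ≡ b
          fv≡b = proj₁ (proj₂ (proj₂ (proj₂ (proj₂ edge))))
          uv : T (adj g u v)
          uv = proj₂ (proj₂ (proj₂ (proj₂ (proj₂ edge))))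
          Gv≡Gu : lookup G v ≡ lookup G u
          Gv≡Gu = begin
            lookup G v                ≡⟨ κ∘f v ⟨
            lookup κ (lookup f v)     ≡⟨ cong (lookup κ) fv≡b ⟩
            lookup κ b                ≡⟨ κa≡κb ⟨
            lookup κ a                ≡⟨ cong (lookup κ) fu≡a ⟨
            lookup κ (lookup f u)     ≡⟨ κ∘f u ⟩
            lookup G u                ∎
            where open ≡-Reasoning
          uv-piece : T (piece u v)
          uv-piece = ∧-intro (fromWitness Gv≡Gu)
            (reachB-mono g {colourClass u} (≤-trans (s≤s z≤n) (Fin.toℕ<n u)) {u} {v}
              (reachB-extend g {colourClass u} 0 u (reachB-refl g (colourClass u) 0 u) (fromWitness Gv≡Gu) uv))
          fv≡fu : lookup f v ≡ lookup f u
          fv≡fu = toWitness (subst T (sym (block≡piece u v)) uv-piece)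

        sizes : ∀ i → d * card ℓ (λ a → ⌊ lookup κ a ≟F i ⌋) ≡ List.lookup e i
        sizes i = trans (sym (card-∘ (lookup f) (lookup κ) (λ a → card-inA A g (blocks a)) i))
                        (trans (count-cong (λ v → cong (λ c → ⌊ c ≟F i ⌋) (κ∘f v)) (allFin n)) (size i))

        triple : Triple
        triple = ℓ , f , κ

        valid : Valid triple
        valid = record { partition = partition ; blocks = blocks ; proper = proper ; sizes = sizes }

        compose≡G : compose triple ≡ G
        compose≡G = lookup-ext _ G λ v → trans (lookup-compose f κ v) (κ∘f v)

      coeffRHS≡orderedCount : coeffRHS A g e ≡ orderedCount A g e
      coeffRHS≡orderedCount = trans coeffRHS≡count-valid
        (count-bijection _≟T_ _≟V_ isValid (admissible e) compose triples (allVecs (length e) n)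
          (λ { t@(ℓ , f , κ) vt → occursOnce-triples (#blocks≤n (Valid.partition (valid⁻ t vt))) })
          (λ G _ → occursOnce-allVecs (length e) n G)
          (λ t vt → admissible⁺ (valid⇒admissible t (valid⁻ t vt)))
          (λ t t′ vt vt′ → compose-injective t t′ (valid⁻ t vt) (valid⁻ t′ vt′))
          (λ G aG → let open Decompose G (admissible⁻ aG) in triple , valid⁺ triple valid , compose≡G))

-- Compositions

_≟L_ : DecidableEquality (List ℕ)
_≟L_ = List.≡-dec _≟_

⌊≟L⌋-∷ : ∀ x y xs ys → ⌊ (x ∷ xs) ≟L (y ∷ ys) ⌋ ≡ ⌊ x ≟ y ⌋ ∧ ⌊ xs ≟L ys ⌋
⌊≟L⌋-∷ x y xs ys with x ≟ y | xs ≟L ys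
... | yes _ | yes _ = refl
... | yes _ | no _  = refl
... | no _  | _     = refl

data Positive : List ℕ → Set where
  []  : Positive []
  _∷_ : ∀ {c} x → Positive c → Positive (suc x ∷ c)

positive-compress : ∀ e → Positive (compress e)
positive-compress []          = []
positive-compress (zero ∷ e)  = positive-compress e
positive-compress (suc x ∷ e) = x ∷ positive-compress e

sum-compress : ∀ e → sum (compress e) ≡ sum e
sum-compress []          = refl
sum-compress (zero ∷ e)  = sum-compress e
sum-compress (suc x ∷ e) = cong (suc x +_) (sum-compress e)

count-compsF : ∀ fuel m {c} → Positive c → m ≤ fuel
  → count (λ α → ⌊ α ≟L c ⌋) (compsF fuel m) ≡ 𝟙 ⌊ sum c ≟ m ⌋
count-compsF fuel    zero    []       _ = refl
count-compsF fuel    zero    (x ∷ c)  _ = refl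
count-compsF (suc f) (suc m) []       _ =
  trans (count-concatMap isEmpty (λ p → map (suc p ∷_) (compsF f (m ∸ p))) (upTo (suc m)))
        (trans (cong sum (List.map-cong (λ p → trans (count-map isEmpty (suc p ∷_) (compsF f (m ∸ p)))
                                                      (count-none (compsF f (m ∸ p)) (λ _ ()))) (upTo (suc m))))
               (trans (sum-map-const 0 (upTo (suc m))) (*-zeroʳ (length (upTo (suc m))))))
  where
  isEmpty : List ℕ → Bool
  isEmpty α = ⌊ α ≟L [] ⌋
count-compsF (suc f) (suc m) {suc x ∷ c} (_ ∷ pc) (s≤s m≤f) = begin
  count (λ α → ⌊ α ≟L (suc x ∷ c) ⌋) (concatMap (λ p → map (suc p ∷_) (compsF f (m ∸ p))) (upTo (suc m)))
    ≡⟨ count-concatMap (λ α → ⌊ α ≟L (suc x ∷ c) ⌋) (λ p → map (suc p ∷_) (compsF f (m ∸ p))) (upTo (suc m)) ⟩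
  sum (map (λ p → count (λ α → ⌊ α ≟L (suc x ∷ c) ⌋) (map (suc p ∷_) (compsF f (m ∸ p)))) (upTo (suc m)))
    ≡⟨ cong sum (List.map-cong by-first-part (upTo (suc m))) ⟩
  sum (map (λ p → if ⌊ p ≟ x ⌋ then rest else 0) (upTo (suc m)))
    ≡⟨ sum-map-if _ rest (upTo (suc m)) ⟩
  count (λ p → ⌊ p ≟ x ⌋) (upTo (suc m)) * rest
    ≡⟨ split (x <? suc m) ⟩
  𝟙 ⌊ suc x + sum c ≟ suc m ⌋ ∎
  where
  open ≡-Reasoning
  rest = count (λ α → ⌊ α ≟L c ⌋) (compsF f (m ∸ x))
  by-first-part : ∀ p → count (λ α → ⌊ α ≟L (suc x ∷ c) ⌋) (map (suc p ∷_) (compsF f (m ∸ p)))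
                      ≡ (if ⌊ p ≟ x ⌋ then rest else 0)
  by-first-part p = trans (count-map (λ α → ⌊ α ≟L (suc x ∷ c) ⌋) (suc p ∷_) (compsF f (m ∸ p)))
                 (trans (count-cong (λ α → trans (⌊≟L⌋-∷ (suc p) (suc x) α c)
                                              (cong (_∧ ⌊ α ≟L c ⌋) (⌊≟⌋-cong _≟_ _≟_ suc-injective (cong suc))))
                                    (compsF f (m ∸ p)))
                 (trans (count-∧ˡ ⌊ p ≟ x ⌋ (λ α → ⌊ α ≟L c ⌋) (compsF f (m ∸ p))) only-x))
    where
    only-x : (if ⌊ p ≟ x ⌋ then count (λ α → ⌊ α ≟L c ⌋) (compsF f (m ∸ p)) else 0)
           ≡ (if ⌊ p ≟ x ⌋ then rest else 0)
    only-x with p ≟ x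
    ... | yes refl = refl
    ... | no _     = refl
  split : Dec (x < suc m) → count (λ p → ⌊ p ≟ x ⌋) (upTo (suc m)) * rest ≡ 𝟙 ⌊ suc x + sum c ≟ suc m ⌋
  split (yes x<1+m) = begin
    count (λ p → ⌊ p ≟ x ⌋) (upTo (suc m)) * rest  ≡⟨ cong (_* rest) (occursOnce-upTo x<1+m) ⟩
    1 * rest                                       ≡⟨ *-identityˡ rest ⟩
    rest                                           ≡⟨ count-compsF f (m ∸ x) pc (≤-trans (m∸n≤m m x) m≤f) ⟩
    𝟙 ⌊ sum c ≟ m ∸ x ⌋                             ≡⟨ cong 𝟙 (⌊≟⌋-cong _≟_ _≟_ to from) ⟩
    𝟙 ⌊ suc x + sum c ≟ suc m ⌋                     ∎
    where
    to : sum c ≡ m ∸ x → suc x + sum c ≡ suc m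
    to eq = cong suc (trans (cong (x +_) eq) (m+[n∸m]≡n (m<1+n⇒m≤n x<1+m)))
    from : suc x + sum c ≡ suc m → sum c ≡ m ∸ x
    from eq = trans (sym (m+n∸m≡n x (sum c))) (cong (_∸ x) (suc-injective eq))
  split (no x≮1+m) = begin
    count (λ p → ⌊ p ≟ x ⌋) (upTo (suc m)) * rest  ≡⟨ cong (_* rest) (count-upTo-≥ (≮⇒≥ x≮1+m)) ⟩
    0                                              ≡⟨ 𝟙-intro _ (λ t → ⊥-elim (x≮1+m (s≤s (too-big (toWitness t)))))
                                                                 (λ _ → refl) ⟩
    𝟙 ⌊ suc x + sum c ≟ suc m ⌋                     ∎
    where
    too-big : suc x + sum c ≡ suc m → x ≤ m
    too-big eq = subst (x ≤_) (suc-injective eq) (m≤m+n x (sum c))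

sum-lookup : ∀ (α : List ℕ) → sum (map (List.lookup α) (allFin (length α))) ≡ sum α
sum-lookup α = cong sum (trans (List.map-tabulate (λ i → i) (List.lookup α)) (List.tabulate-lookup α))

embed : ∀ e → Fin (length (compress e)) → Fin (length e)
embed (zero ∷ e)  a       = suc (embed e a)
embed (suc x ∷ e) zero    = zero
embed (suc x ∷ e) (suc a) = suc (embed e a)

lookup-embed : ∀ e a → List.lookup e (embed e a) ≡ List.lookup (compress e) a
lookup-embed (zero ∷ e)  a       = lookup-embed e a
lookup-embed (suc x ∷ e) zero    = refl
lookup-embed (suc x ∷ e) (suc a) = lookup-embed e a

embed-injective : ∀ e {a b} → embed e a ≡ embed e b → a ≡ b
embed-injective (zero ∷ e)  eq = embed-injective e (Fin.suc-injective eq)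
embed-injective (suc x ∷ e) {zero}  {zero}  eq = refl
embed-injective (suc x ∷ e) {suc a} {suc b} eq = cong suc (embed-injective e (Fin.suc-injective eq))

embed-onto : ∀ e i → List.lookup e i ≢ 0 → ∃ λ a → embed e a ≡ i
embed-onto (zero ∷ e)  zero    e₀≢0 = ⊥-elim (e₀≢0 refl)
embed-onto (zero ∷ e)  (suc i) eᵢ≢0 = let a , eq = embed-onto e i eᵢ≢0 in a , cong suc eq
embed-onto (suc x ∷ e) zero    _    = zero , refl
embed-onto (suc x ∷ e) (suc i) eᵢ≢0 = let a , eq = embed-onto e i eᵢ≢0 in suc a , cong suc eq

module _ {d n : ℕ} (A : Graph d → Bool) (g : Graph n) where

  admissible⇒sum≡n : ∀ {α G} → Admissible A g α G → sum α ≡ n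
  admissible⇒sum≡n {α} {G} adm = begin
    sum α
      ≡⟨ sum-lookup α ⟨
    sum (map (List.lookup α) (allFin (length α)))
      ≡⟨ cong sum (List.map-cong (λ i → sym (size i)) (allFin (length α))) ⟩
    sum (map (λ i → card n (λ v → ⌊ lookup G v ≟F i ⌋)) (allFin (length α)))
      ≡⟨ card-fibres (lookup G) (λ _ → true) ⟨
    card n (λ _ → true)
      ≡⟨ card-all ⟩
    n ∎
    where
    open ≡-Reasoning
    open Admissible adm

  block-nonzero : ∀ {α G} → Admissible A g α G → ∀ v → List.lookup α (lookup G v) ≢ 0
  block-nonzero {G = G} adm v eq = <-irrefl (sym (trans (Admissible.size adm (lookup G v)) eq))
                                            (card-pos (block G (lookup G v)) v (⌊≟⌋-refl _≟F_ (lookup G v)))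

  module _ (e : List ℕ) where

    embedAll : Vec (Fin (length (compress e))) n → Vec (Fin (length e)) n
    embedAll = Vec.map (embed e)

    block-embedAll : ∀ F a x → block (embedAll F) (embed e a) x ≡ block F a x
    block-embedAll F a x = trans (cong (λ b → ⌊ b ≟F embed e a ⌋) (Vec.lookup-map x (embed e) F))
                                 (⌊≟⌋-cong _≟F_ _≟F_ (embed-injective e) (cong (embed e)))

    admissible-embedAll : ∀ F → Admissible A g (compress e) F → Admissible A g e (embedAll F)
    admissible-embedAll F adm = record { size = size′ ; zeta = zeta′ }
      where
      open Admissible adm
      empty : ∀ i → List.lookup e i ≡ 0 → ∀ x → ¬ T (block (embedAll F) i x)
      empty i eᵢ≡0 x t = block-nonzero adm x (trans (sym (lookup-embed e (lookup F x)))
        (trans (cong (List.lookup e) (trans (sym (Vec.lookup-map x (embed e) F)) (toWitness t))) eᵢ≡0))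
      size′ : ∀ i → card n (block (embedAll F) i) ≡ List.lookup e i
      size′ i with List.lookup e i ≟ 0
      ... | yes eᵢ≡0 = trans (count-none (allFin n) (empty i eᵢ≡0)) (sym eᵢ≡0)
      ... | no eᵢ≢0 with embed-onto e i eᵢ≢0
      ... | a , refl = trans (count-cong (block-embedAll F a) (allFin n)) (trans (size a) (sym (lookup-embed e a)))
      zeta′ : ∀ i → T (zetaA A g (block (embedAll F) i))
      zeta′ i with List.lookup e i ≟ 0
      ... | yes eᵢ≡0 = zetaA⁺ A g (λ v t → ⊥-elim (empty i eᵢ≡0 v t))
      ... | no eᵢ≢0 with embed-onto e i eᵢ≢0
      ... | a , refl = subst T (sym (zetaA-cong A g (block-embedAll F a))) (zeta a)

    unembedAll : ∀ G → Admissible A g e G → ∃ λ F → Admissible A g (compress e) F × embedAll F ≡ G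
    unembedAll G adm = F , record { size = size′ ; zeta = zeta′ } , embed∘F
      where
      open Admissible adm
      F : Vec (Fin (length (compress e))) n
      F = tabulate λ v → proj₁ (embed-onto e (lookup G v) (block-nonzero adm v))
      embed∘F : embedAll F ≡ G
      embed∘F = lookup-ext _ G λ v → trans (Vec.lookup-map v (embed e) F)
        (trans (cong (embed e) (Vec.lookup∘tabulate _ v)) (proj₂ (embed-onto e (lookup G v) (block-nonzero adm v))))
      block-F : ∀ a x → block F a x ≡ block G (embed e a) x
      block-F a x = trans (sym (block-embedAll F a x)) (cong (λ H → block H (embed e a) x) embed∘F)
      size′ : ∀ a → card n (block F a) ≡ List.lookup (compress e) a
      size′ a = trans (count-cong (block-F a) (allFin n)) (trans (size (embed e a)) (lookup-embed e a))
      zeta′ : ∀ a → T (zetaA A g (block F a))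
      zeta′ a = subst T (sym (zetaA-cong A g (block-F a))) (zeta (embed e a))

    orderedCount-compress : orderedCount A g (compress e) ≡ orderedCount A g e
    orderedCount-compress = count-bijection _≟V_ _≟V_ (admissible A g (compress e)) (admissible A g e) embedAll
      (allVecs (length (compress e)) n) (allVecs (length e) n)
      (λ F _ → occursOnce-allVecs _ n F) (λ G _ → occursOnce-allVecs _ n G)
      (λ F a → admissible⁺ A g (admissible-embedAll F (admissible⁻ A g a)))
      (λ F F′ _ _ eq → lookup-ext F F′ λ v → embed-injective e (trans (sym (Vec.lookup-map v (embed e) F))
                                              (trans (cong (λ H → lookup H v) eq) (Vec.lookup-map v (embed e) F′))))
      (λ G a → let F , adm , eq = unembedAll G (admissible⁻ A g a) in F , admissible⁺ A g adm , eq)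

    coeffΨ≡orderedCount : coeffΨ A g e ≡ orderedCount A g e
    coeffΨ≡orderedCount = begin
      coeffΨ A g e
        ≡⟨ cong sum (List.map-cong term (compositions n)) ⟩
      sum (map (λ α → if ⌊ compress e ≟L α ⌋ then orderedCount A g (compress e) else 0) (compositions n))
        ≡⟨ sum-map-if _ _ (compositions n) ⟩
      count (λ α → ⌊ compress e ≟L α ⌋) (compositions n) * orderedCount A g (compress e)
        ≡⟨ cong (_* orderedCount A g (compress e)) (trans (count-cong (⌊≟⌋-sym _≟L_ (compress e)) (compositions n))
                              (count-compsF n n (positive-compress e) ≤-refl)) ⟩
      𝟙 ⌊ sum (compress e) ≟ n ⌋ * orderedCount A g (compress e)
        ≡⟨ cong (λ s → 𝟙 ⌊ s ≟ n ⌋ * orderedCount A g (compress e)) (sum-compress e) ⟩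
      𝟙 ⌊ sum e ≟ n ⌋ * orderedCount A g (compress e)
        ≡⟨ by-total-size ⟩
      orderedCount A g e ∎
      where
      open ≡-Reasoning
      term : ∀ α → orderedCount A g α * coeffM α e ≡ (if ⌊ compress e ≟L α ⌋ then orderedCount A g (compress e) else 0)
      term α with compress e ≟L α
      ... | yes refl = *-identityʳ (orderedCount A g α)
      ... | no _     = *-zeroʳ (orderedCount A g α)
      by-total-size : 𝟙 ⌊ sum e ≟ n ⌋ * orderedCount A g (compress e) ≡ orderedCount A g e
      by-total-size with sum e ≟ n
      ... | yes _   = trans (+-identityʳ _) orderedCount-compress
      ... | no Σe≢n = sym (count-none {p = admissible A g e} (allVecs (length e) n) λ G a →
                          Σe≢n (admissible⇒sum≡n (admissible⁻ A g {e} {G} a)))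

lemma4p1 : {d n : ℕ} (A : Graph d → Bool)
    → (∀ h → A h ≡ true → IsSimple h × Connected h)
    → (g : Graph n) → IsSimple g
    → (∀ (e : List ℕ) → coeffΨ A g e ≡ coeffRHS A g e)
      × (¬ (d ∣ n) → ∀ (e : List ℕ) → coeffΨ A g e ≡ 0)
lemma4p1 A A-connected g _ = Ψ≡RHS , λ d∤n e → trans (Ψ≡RHS e) (coeffRHS≡0 A g e d∤n)
  where
  connected : ∀ h → T (A h) → Connected h
  connected h a = proj₂ (A-connected h (Equivalence.to T-≡ a))
  Ψ≡RHS : ∀ e → coeffΨ A g e ≡ coeffRHS A g e
  Ψ≡RHS e = trans (coeffΨ≡orderedCount A g e) (sym (coeffRHS≡orderedCount A g e connected))
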